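{- Let $H$ be a strongly regular graph with parameters $(n,d,0,1)$ and let $G$ be its line graph. Then every edge $xy$ of $G$ has Lin–Lu–Yau curvature $\kappa(x,y)=\frac{1}{2d-2}$.
   Context: A strongly regular graph with parameters $(n,d,\alpha,\beta)$ is a finite simple non-complete connected $d$-regular graph on $n$ vertices of diameter $2$ in which any two adjacent vertices have exactly $\alpha$ common neighbours and any two non-adjacent distinct vertices have exactly $\beta$ common neighbours. Lin–Lu–Yau curvature: for a vertex $x$ and $p\in[0,1]$ let $\mu_x^p(x)=p$, $\mu_x^p(y)=(1-p)/\deg(x)$ for neighbours $y$ of $x$, and $0$ otherwise; $W_1$ is the $L^1$-Wasserstein (optimal transport) distance with respect to the graph distance $d$; $\kappa_p(x,y)=1-W_1(\mu_x^p,\mu_y^p)/d(x,y)$ and $\kappa(x,y)=\lim_{p\to1}\kappa_p(x,y)/(1-p)$.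
   Formalization: The parameter p in the limit p → 1 defining κ(x,y) ranges over the rationals, and the couplings over which W₁ is optimised take rational values. -}

module Defs where

open import Data.Bool using (Bool; true; false; _∧_; _∨_; if_then_else_; T; not)
open import Data.Bool.Properties using (T-irrelevant)
open import Data.Nat as ℕ using (ℕ; zero; suc)
open import Data.Fin as Fin using (Fin; toℕ)
open import Data.Fin.Properties using () renaming (_≟_ to _≟ᶠ_)
open import Data.Integer using (+_)
open import Data.Rational using (ℚ; _/_; 0ℚ; 1ℚ; _+_; _-_; _*_; _≤_; _<_; ∣_∣)
open import Data.List using (List; []; _∷_; map; foldr; length; allFin; cartesianProduct; mapMaybe)
open import Data.Bool.ListAction using (any)
open import Data.Maybe using (Maybe; just; nothing)
open import Data.Product using (Σ; _×_; _,_; ∃; proj₁; proj₂)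
open import Data.Product.Properties using (≡-dec)
open import Relation.Binary.PropositionalEquality using (_≡_; _≢_; refl)
open import Relation.Binary.Definitions using (DecidableEquality)
open import Relation.Nullary using (yes; no; ⌊_⌋)
open import Relation.Nullary.Decidable using (T?)

countFin : {n : ℕ} → (Fin n → Bool) → ℕ
countFin {n} f = foldr ℕ._+_ 0 (map (λ z → if f z then 1 else 0) (allFin n))

common : {n : ℕ} → (Fin n → Fin n → Bool) → Fin n → Fin n → ℕ
common A x y = countFin (λ z → A x z ∧ A y z)

record IsSRG (n : ℕ) (A : Fin n → Fin n → Bool) (d α β : ℕ) : Set where
  field
    symmetric   : ∀ x y → A x y ≡ A y x
    irreflexive : ∀ x → A x x ≡ false
    regular     : ∀ x → countFin (A x) ≡ d
    nonComplete : Σ (Fin n) λ x → Σ (Fin n) λ y → x ≢ y × A x y ≡ false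
    -- connected of diameter 2: distinct non-adjacent vertices are at distance 2
    diameter2   : ∀ x y → x ≢ y → A x y ≡ false →
                  Σ (Fin n) λ z → A x z ≡ true × A z y ≡ true
    adjCommon   : ∀ x y → A x y ≡ true → common A x y ≡ α
    nonAdjCommon : ∀ x y → x ≢ y → A x y ≡ false → common A x y ≡ β

-- 1/m for m > 0 (and 0 for m = 0, never used for our graphs)
invℕ : ℕ → ℚ
invℕ zero    = 0ℚ
invℕ (suc m) = + 1 / suc m

record FinGraph : Set₁ where
  field
    V     : Set
    elems : List V          -- every vertex exactly once
    _≟V_  : DecidableEquality V
    adj   : V → V → Bool

module _ (G : FinGraph) where
  open FinGraph G

  sumV : (V → ℚ) → ℚ
  sumV f = foldr _+_ 0ℚ (map f elems)

  degree : V → ℕ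
  degree x = foldr ℕ._+_ 0 (map (λ z → if adj x z then 1 else 0) elems)

  reach : ℕ → V → V → Bool
  reach zero    x y = ⌊ x ≟V y ⌋
  reach (suc k) x y = reach k x y ∨ any (λ z → reach k x z ∧ adj z y) elems

  firstReach : ℕ → ℕ → V → V → ℕ
  firstReach zero     k x y = k
  firstReach (suc f)  k x y = if reach k x y then k else firstReach f (suc k) x y

  -- graph distance (for connected graphs)
  dist : V → V → ℕ
  dist x y = firstReach (length elems) 0 x y

  Measure : Set
  Measure = V → ℚ

  Coupling : Measure → Measure → (V → V → ℚ) → Set
  Coupling μ ν π = (∀ u v → 0ℚ ≤ π u v)
                 × (∀ u → sumV (λ v → π u v) ≡ μ u)
                 × (∀ v → sumV (λ u → π u v) ≡ ν v)

  cost : (V → V → ℚ) → ℚ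
  cost π = sumV (λ u → sumV (λ v → π u v * (+ dist u v / 1)))

  -- W₁(μ,ν) = w  (the infimum over couplings, which is attained)
  IsW1 : Measure → Measure → ℚ → Set
  IsW1 μ ν w = (Σ (V → V → ℚ) λ π → Coupling μ ν π × cost π ≡ w)
             × (∀ π → Coupling μ ν π → w ≤ cost π)

  lazyMeasure : ℚ → V → Measure
  lazyMeasure p x z =
    if ⌊ z ≟V x ⌋ then p
    else if adj x z then (1ℚ - p) * invℕ (degree x) else 0ℚ

  -- κ_p(x,y) = k, i.e. k = 1 - W₁(μ_x^p, μ_y^p)/d(x,y)  (written multiplicatively)
  IsKappaP : ℚ → V → V → ℚ → Set
  IsKappaP p x y k = Σ ℚ λ w → IsW1 (lazyMeasure p x) (lazyMeasure p y) w
                     × k * (+ dist x y / 1) ≡ (+ dist x y / 1) - w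

  -- κ(x,y) = lim_{p→1} κ_p(x,y)/(1-p) = K   (ε-δ, over rational p)
  IsLLYCurvature : V → V → ℚ → Set
  IsLLYCurvature x y K =
    ∀ ε → 0ℚ < ε → Σ ℚ λ δ → 0ℚ < δ ×
      (∀ p → 0ℚ ≤ p → 1ℚ - δ < p → p < 1ℚ →
        Σ ℚ λ k → IsKappaP p x y k × ∣ k - K * (1ℚ - p) ∣ < ε * (1ℚ - p))

module _ {n : ℕ} (A : Fin n → Fin n → Bool) where

  -- an edge is stored as (u , v) with u < v and u ~ v
  isOrdEdge : Fin n × Fin n → Bool
  isOrdEdge (u , v) = (toℕ u ℕ.<ᵇ toℕ v) ∧ A u v

  Edge : Set
  Edge = Σ (Fin n × Fin n) λ e → T (isOrdEdge e)

  _≟E_ : DecidableEquality Edge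
  (e , t) ≟E (f , s) with ≡-dec _≟ᶠ_ _≟ᶠ_ e f
  ... | yes refl with T-irrelevant t s
  ...   | refl = yes refl
  (e , t) ≟E (f , s) | no e≢f = no λ { refl → e≢f refl }

  toEdge : Fin n × Fin n → Maybe Edge
  toEdge e with T? (isOrdEdge e)
  ... | yes t = just (e , t)
  ... | no  _ = nothing

  edges : List Edge
  edges = mapMaybe toEdge (cartesianProduct (allFin n) (allFin n))

  lineAdj : Edge → Edge → Bool
  lineAdj ((u , v) , _) ((u' , v') , _) =
    (not (⌊ u ≟ᶠ u' ⌋ ∧ ⌊ v ≟ᶠ v' ⌋)) ∧
    (⌊ u ≟ᶠ u' ⌋ ∨ ⌊ u ≟ᶠ v' ⌋ ∨ ⌊ v ≟ᶠ u' ⌋ ∨ ⌊ v ≟ᶠ v' ⌋)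

  LineGraph : FinGraph
  LineGraph = record { V = Edge ; elems = edges ; _≟V_ = _≟E_ ; adj = lineAdj }

{-# OPTIONS --safe #-}
-- Let x = ab and y = bc be adjacent vertices of the line graph.  A strongly regular graph with
-- parameters (n,d,0,1) has no triangles and any two non-adjacent vertices have exactly one common
-- neighbour, so a ≁ c and the line graph is (2d-2)-regular; put m = (1-p)/(2d-2).  For p ≥ ½ the
-- following plan transports μ_x^p to μ_y^p: mass m stays on every edge through b, mass p - m moves
-- from x to y, and the mass m on each edge aa′ (a′ ≠ b) moves to the edge cc′ where c′ is the common
-- neighbour of a′ and c; these two edges are at distance 2 (via a′c′), and aa′ ↦ cc′ is a bijection
-- onto the edges at c other than y.  The plan costs (p - m) + 2(d-1)m = 1 - m.  The potential equal
-- to 2 on the edges at a, 0 on the edges at c other than y and 1 elsewhere is 1-Lipschitz and is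
-- tight on the support of the plan, so W₁ = 1 - m and κ_p(x,y) = m = (1-p)/(2d-2) for all p ∈ (½,1).
module Submission where

open import Defs
open import Data.Bool using (Bool; true; false; _∧_; _∨_; _xor_; not; if_then_else_; T)
import Data.Bool.Properties as 𝔹
open import Data.Nat as ℕ using (ℕ; zero; suc; _∸_; _≤_; s≤s; z≤n; NonZero)
import Data.Nat.Properties as ℕ
open import Data.Fin as Fin using (Fin; toℕ)
import Data.Fin.Properties as Fin
import Data.Integer as ℤ
import Data.Integer.Properties as ℤ
import Data.Nat.Coprimality as Coprime
open import Data.Rational as ℚ using (ℚ; 0ℚ; 1ℚ; ½; mkℚ; _+_; _*_; _-_; ∣_∣)
  renaming (_≤_ to _≤ℚ_; _<_ to _<ℚ_)
import Data.Rational.Properties as ℚ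
open import Data.Rational.Solver using (module +-*-Solver)
open import Data.List using (List; []; _∷_; map; foldr; length; allFin; cartesianProduct; mapMaybe; _++_)
open import Data.List.Properties using (map-tabulate)
open import Data.List.Membership.Propositional using (_∈_)
open import Data.List.Membership.Propositional.Properties using (∈-allFin; ∈-cartesianProduct⁺; ∈-length)
open import Data.Bool.ListAction using (any)
open import Data.List.Relation.Unary.Any using (here; there)
open import Data.Maybe using (Maybe; just; nothing; maybe′)
open import Data.Product using (Σ; _×_; _,_; proj₁; proj₂)
open import Data.Sum using (_⊎_; inj₁; inj₂)
open import Data.Empty using (⊥-elim)
open import Data.Unit using (tt)
open import Function.Bundles using (Equivalence)
open import Relation.Nullary using (yes; no; ⌊_⌋; ¬_)
open import Relation.Nullary.Decidable using (T?; isYes≗does; dec-true; dec-false)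
open import Relation.Binary.Definitions using (DecidableEquality; tri<; tri≈; tri>)
open import Relation.Binary.PropositionalEquality
  using (_≡_; _≢_; refl; sym; trans; cong; cong₂; subst; subst₂; ≢-sym; module ≡-Reasoning)

open +-*-Solver

module _ {X : Set} (_≟_ : DecidableEquality X) where

  ≟-refl : ∀ x → ⌊ x ≟ x ⌋ ≡ true
  ≟-refl x = trans (isYes≗does (x ≟ x)) (dec-true (x ≟ x) refl)

  ≟-true : ∀ {x y} → ⌊ x ≟ y ⌋ ≡ true → x ≡ y
  ≟-true {x} {y} eq with x ≟ y
  ≟-true _  | yes x≡y = x≡y
  ≟-true () | no _

  ≟-≢ : ∀ {x y} → x ≢ y → ⌊ x ≟ y ⌋ ≡ false
  ≟-≢ {x} {y} x≢y = trans (isYes≗does (x ≟ y)) (dec-false (x ≟ y) x≢y)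

∧-true : ∀ {b c} → b ∧ c ≡ true → b ≡ true × c ≡ true
∧-true {true} c≡true = refl , c≡true

not-true : ∀ {b} → not b ≡ true → b ≡ false
not-true {false} _ = refl

<ᵇ-true : ∀ {i j} → i ℕ.< j → (i ℕ.<ᵇ j) ≡ true
<ᵇ-true i<j = Equivalence.to 𝔹.T-≡ (ℕ.<⇒<ᵇ i<j)

¬T⇒≡false : ∀ {b} → ¬ T b → b ≡ false
¬T⇒≡false ¬b = 𝔹.¬-not (λ b≡true → ¬b (Equivalence.from 𝔹.T-≡ b≡true))

<ᵇ-false : ∀ {i j} → ¬ i ℕ.< j → (i ℕ.<ᵇ j) ≡ false
<ᵇ-false {i} {j} i≮j = ¬T⇒≡false (λ i<ᵇj → i≮j (ℕ.<ᵇ⇒< i j i<ᵇj))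

module _ {X : Set} where

  any-true : (L : List X) (f : X → Bool) {z : X} → z ∈ L → f z ≡ true → any f L ≡ true
  any-true (x ∷ L) f (here refl) fz rewrite fz = refl
  any-true (x ∷ L) f (there z∈L) fz = trans (cong (f x ∨_) (any-true L f z∈L fz)) (𝔹.∨-zeroʳ (f x))

  any-false : (L : List X) (f : X → Bool) → (∀ z → f z ≡ false) → any f L ≡ false
  any-false []      f none = refl
  any-false (x ∷ L) f none rewrite none x = any-false L f none

  length-≥2 : {L : List X} {z₁ z₂ : X} → z₁ ∈ L → z₂ ∈ L → z₁ ≢ z₂ → 2 ≤ length L
  length-≥2 (here refl)  (here refl)  z₁≢z₂ = ⊥-elim (z₁≢z₂ refl)
  length-≥2 (here refl)  (there z₂∈L) _     = s≤s (∈-length z₂∈L)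
  length-≥2 (there z₁∈L) (here refl)  _     = s≤s (∈-length z₁∈L)
  length-≥2 (there z₁∈L) (there z₂∈L) z₁≢z₂ = ℕ.m≤n⇒m≤1+n (length-≥2 z₁∈L z₂∈L z₁≢z₂)

∈-mapMaybe⁺ : {X Y : Set} (h : X → Maybe Y) {L : List X} {x : X} {y : Y} → x ∈ L → h x ≡ just y → y ∈ mapMaybe h L
∈-mapMaybe⁺ h {x ∷ L} (here refl) hx≡y rewrite hx≡y = here refl
∈-mapMaybe⁺ h {x ∷ L} (there x∈L) hx≡y with h x
... | just _  = there (∈-mapMaybe⁺ h x∈L hx≡y)
... | nothing = ∈-mapMaybe⁺ h x∈L hx≡y

∑ : {X : Set} → List X → (X → ℚ) → ℚ
∑ L f = foldr _+_ 0ℚ (map f L)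

module _ {X : Set} where

  ∑-cong : (L : List X) {f g : X → ℚ} → (∀ u → f u ≡ g u) → ∑ L f ≡ ∑ L g
  ∑-cong []      eq = refl
  ∑-cong (x ∷ L) eq = cong₂ _+_ (eq x) (∑-cong L eq)

  ∑-zero : (L : List X) {f : X → ℚ} → (∀ u → f u ≡ 0ℚ) → ∑ L f ≡ 0ℚ
  ∑-zero []      eq = refl
  ∑-zero (x ∷ L) eq = cong₂ _+_ (eq x) (∑-zero L eq)

  ∑-distrib-+ : (L : List X) (f g : X → ℚ) → ∑ L (λ u → f u + g u) ≡ ∑ L f + ∑ L g
  ∑-distrib-+ []      f g = refl
  ∑-distrib-+ (x ∷ L) f g = trans (cong ((f x + g x) +_) (∑-distrib-+ L f g))
                                   (solve 4 (λ a b c e → a :+ b :+ (c :+ e) := a :+ c :+ (b :+ e)) refl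
                                            (f x) (g x) (∑ L f) (∑ L g))

  *-distribˡ-∑ : (L : List X) (c : ℚ) (f : X → ℚ) → ∑ L (λ u → c * f u) ≡ c * ∑ L f
  *-distribˡ-∑ []      c f = sym (ℚ.*-zeroʳ c)
  *-distribˡ-∑ (x ∷ L) c f = trans (cong (c * f x +_) (*-distribˡ-∑ L c f))
                                   (sym (ℚ.*-distribˡ-+ c (f x) (∑ L f)))

  ∑-neg : (L : List X) (f : X → ℚ) → ∑ L (λ u → ℚ.- f u) ≡ ℚ.- ∑ L f
  ∑-neg []      f = refl
  ∑-neg (x ∷ L) f = trans (cong (ℚ.- f x +_) (∑-neg L f)) (sym (ℚ.neg-distrib-+ (f x) (∑ L f)))

  ∑-distrib-sub : (L : List X) (f g : X → ℚ) → ∑ L (λ u → f u - g u) ≡ ∑ L f - ∑ L g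
  ∑-distrib-sub L f g = trans (∑-distrib-+ L f (λ u → ℚ.- g u)) (cong (∑ L f +_) (∑-neg L g))

  ∑-mono-≤ : (L : List X) {f g : X → ℚ} → (∀ u → f u ≤ℚ g u) → ∑ L f ≤ℚ ∑ L g
  ∑-mono-≤ []      le = ℚ.≤-refl
  ∑-mono-≤ (x ∷ L) le = ℚ.+-mono-≤ (le x) (∑-mono-≤ L le)

  ∑-++ : (L M : List X) (f : X → ℚ) → ∑ (L ++ M) f ≡ ∑ L f + ∑ M f
  ∑-++ []      M f = sym (ℚ.+-identityˡ _)
  ∑-++ (x ∷ L) M f = trans (cong (f x +_) (∑-++ L M f)) (sym (ℚ.+-assoc (f x) _ _))

∑-map : {X Y : Set} (L : List X) (h : X → Y) (f : Y → ℚ) → ∑ (map h L) f ≡ ∑ L (λ u → f (h u))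
∑-map []      h f = refl
∑-map (x ∷ L) h f = cong (f (h x) +_) (∑-map L h f)

∑-mapMaybe : {X Y : Set} (L : List X) (h : X → Maybe Y) (f : Y → ℚ) →
             ∑ (mapMaybe h L) f ≡ ∑ L (λ u → maybe′ f 0ℚ (h u))
∑-mapMaybe []      h f = refl
∑-mapMaybe (x ∷ L) h f with h x
... | just y  = cong (f y +_) (∑-mapMaybe L h f)
... | nothing = trans (∑-mapMaybe L h f) (sym (ℚ.+-identityˡ _))

∑-cartesianProduct : {X Y : Set} (L : List X) (M : List Y) (g : X × Y → ℚ) →
                     ∑ (cartesianProduct L M) g ≡ ∑ L (λ s → ∑ M (λ t → g (s , t)))
∑-cartesianProduct []      M g = refl
∑-cartesianProduct (x ∷ L) M g =
  trans (∑-++ (map (x ,_) M) _ g) (cong₂ _+_ (∑-map M (x ,_) g) (∑-cartesianProduct L M g))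

∑-comm : {X Y : Set} (L : List X) (M : List Y) (g : X → Y → ℚ) →
         ∑ L (λ u → ∑ M (g u)) ≡ ∑ M (λ v → ∑ L (λ u → g u v))
∑-comm []      M g = sym (∑-zero M (λ _ → refl))
∑-comm (x ∷ L) M g = trans (cong (∑ M (g x) +_) (∑-comm L M g))
                           (sym (∑-distrib-+ M (g x) (λ v → ∑ L (λ u → g u v))))

∑-allFin-suc : (k : ℕ) (f : Fin (suc k) → ℚ) → ∑ (allFin (suc k)) f ≡ f Fin.zero + ∑ (allFin k) (λ j → f (Fin.suc j))
∑-allFin-suc k f = cong (λ L → f Fin.zero + foldr _+_ 0ℚ L)
                        (trans (map-tabulate Fin.suc f) (sym (map-tabulate (λ j → j) (λ j → f (Fin.suc j)))))

∑-allFin-single : (k : ℕ) (f : Fin k → ℚ) (i : Fin k) → (∀ j → j ≢ i → f j ≡ 0ℚ) → ∑ (allFin k) f ≡ f i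
∑-allFin-single (suc k) f Fin.zero vanish = begin
  ∑ (allFin (suc k)) f                            ≡⟨ ∑-allFin-suc k f ⟩
  f Fin.zero + ∑ (allFin k) (λ j → f (Fin.suc j)) ≡⟨ cong (f Fin.zero +_) (∑-zero (allFin k) (λ j → vanish (Fin.suc j) λ ())) ⟩
  f Fin.zero + 0ℚ                                 ≡⟨ ℚ.+-identityʳ _ ⟩
  f Fin.zero                                      ∎
  where open ≡-Reasoning
∑-allFin-single (suc k) f (Fin.suc i) vanish = begin
  ∑ (allFin (suc k)) f                            ≡⟨ ∑-allFin-suc k f ⟩
  f Fin.zero + ∑ (allFin k) (λ j → f (Fin.suc j)) ≡⟨ cong₂ _+_ (vanish Fin.zero λ ()) (∑-allFin-single k _ i vanish-suc) ⟩
  0ℚ + f (Fin.suc i)                              ≡⟨ ℚ.+-identityˡ _ ⟩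
  f (Fin.suc i)                                   ∎
  where
  open ≡-Reasoning
  vanish-suc : ∀ j → j ≢ i → f (Fin.suc j) ≡ 0ℚ
  vanish-suc j j≢i = vanish (Fin.suc j) (λ eq → j≢i (Fin.suc-injective eq))

fromℕ : ℕ → ℚ
fromℕ k = ℤ.+ k ℚ./ 1

fromℕ≡mkℚ : ∀ k → fromℕ k ≡ mkℚ (ℤ.+ k) 0 (Coprime.sym (Coprime.1-coprimeTo k))
fromℕ≡mkℚ k = ℚ.normalize-coprime (Coprime.sym (Coprime.1-coprimeTo k))

fromℕ-suc : ∀ k → fromℕ (suc k) ≡ 1ℚ + fromℕ k
fromℕ-suc k rewrite fromℕ≡mkℚ k = cong (λ z → (ℤ.+ 1 ℤ.+ z) ℚ./ 1) (sym (ℤ.*-identityʳ (ℤ.+ k)))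

fromℕ-+ : ∀ j k → fromℕ (j ℕ.+ k) ≡ fromℕ j + fromℕ k
fromℕ-+ zero    k = sym (ℚ.+-identityˡ (fromℕ k))
fromℕ-+ (suc j) k = begin
  fromℕ (suc (j ℕ.+ k))      ≡⟨ fromℕ-suc (j ℕ.+ k) ⟩
  1ℚ + fromℕ (j ℕ.+ k)       ≡⟨ cong (1ℚ +_) (fromℕ-+ j k) ⟩
  1ℚ + (fromℕ j + fromℕ k)   ≡⟨ sym (ℚ.+-assoc 1ℚ (fromℕ j) (fromℕ k)) ⟩
  1ℚ + fromℕ j + fromℕ k     ≡⟨ cong (_+ fromℕ k) (sym (fromℕ-suc j)) ⟩
  fromℕ (suc j) + fromℕ k    ∎
  where open ≡-Reasoning

fromℕ-mono-≤ : ∀ {j k} → j ≤ k → fromℕ j ≤ℚ fromℕ k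
fromℕ-mono-≤ {j} {k} j≤k rewrite fromℕ≡mkℚ j | fromℕ≡mkℚ k =
  ℚ.*≤* (subst₂ ℤ._≤_ (sym (ℤ.*-identityʳ (ℤ.+ j))) (sym (ℤ.*-identityʳ (ℤ.+ k))) (ℤ.+≤+ j≤k))

fromℕ-injective : ∀ {j k} → fromℕ j ≡ fromℕ k → j ≡ k
fromℕ-injective {j} {k} eq rewrite fromℕ≡mkℚ j | fromℕ≡mkℚ k = ℤ.+-injective (cong ℚ.numerator eq)

fromℕ-2*d∸2 : ∀ d → 1 ≤ d → fromℕ (2 ℕ.* d ∸ 2) ≡ fromℕ d + fromℕ d - fromℕ 2
fromℕ-2*d∸2 d d≥1 = begin
  fromℕ D                          ≡⟨ solve 2 (λ x y → x := x :+ y :- y) refl (fromℕ D) (fromℕ 2) ⟩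
  fromℕ D + fromℕ 2 - fromℕ 2      ≡⟨ cong (_- fromℕ 2) (sym (fromℕ-+ D 2)) ⟩
  fromℕ (D ℕ.+ 2) - fromℕ 2        ≡⟨ cong (λ k → fromℕ k - fromℕ 2) D+2≡d+d ⟩
  fromℕ (d ℕ.+ d) - fromℕ 2        ≡⟨ cong (_- fromℕ 2) (fromℕ-+ d d) ⟩
  fromℕ d + fromℕ d - fromℕ 2      ∎
  where
  open ≡-Reasoning
  D = 2 ℕ.* d ∸ 2
  D+2≡d+d : D ℕ.+ 2 ≡ d ℕ.+ d
  D+2≡d+d = trans (ℕ.m∸n+n≡m (ℕ.*-monoʳ-≤ 2 d≥1)) (cong (d ℕ.+_) (ℕ.+-identityʳ d))

invℕ-inverseˡ : ∀ k → .{{NonZero k}} → invℕ k * fromℕ k ≡ 1ℚ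
invℕ-inverseˡ (suc k) rewrite fromℕ≡mkℚ (suc k) | ℚ.normalize-coprime {1} {k} (Coprime.1-coprimeTo (suc k)) =
  ℚ.*-inverseˡ (mkℚ (ℤ.+ suc k) 0 (Coprime.sym (Coprime.1-coprimeTo (suc k))))

invℕ-nonNeg : ∀ k → 0ℚ ≤ℚ invℕ k
invℕ-nonNeg zero    = ℚ.≤-refl
invℕ-nonNeg (suc k) rewrite ℚ.normalize-coprime {1} {k} (Coprime.1-coprimeTo (suc k)) = ℚ.nonNegative⁻¹ _

invℕ≤1 : ∀ k → invℕ k ≤ℚ 1ℚ
invℕ≤1 zero    = ℚ.<⇒≤ (ℚ.positive⁻¹ 1ℚ)
invℕ≤1 (suc k) rewrite ℚ.normalize-coprime {1} {k} (Coprime.1-coprimeTo (suc k)) =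
  ℚ.*≤* (subst (ℤ.+ 1 ℤ.* ℤ.+ 1 ℤ.≤_) (sym (ℤ.*-identityˡ (ℤ.+ suc k))) (ℤ.+≤+ (s≤s z≤n)))

p≤q⇒0≤q-p : ∀ {p q} → p ≤ℚ q → 0ℚ ≤ℚ q - p
p≤q⇒0≤q-p {p} {q} p≤q = subst (_≤ℚ q - p) (ℚ.+-inverseʳ p) (ℚ.+-monoˡ-≤ (ℚ.- p) p≤q)

*-nonNeg : ∀ {r s} → 0ℚ ≤ℚ r → 0ℚ ≤ℚ s → 0ℚ ≤ℚ r * s
*-nonNeg {r} {s} r≥0 s≥0 = ℚ.nonNegative⁻¹ _ {{ℚ.nonNeg*nonNeg⇒nonNeg r {{ℚ.nonNegative r≥0}} s {{ℚ.nonNegative s≥0}}}}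

p≤q+r⇒p-r≤q : ∀ {p q r} → p ≤ℚ q + r → p - r ≤ℚ q
p≤q+r⇒p-r≤q {p} {q} {r} le = ℚ.≤-trans (ℚ.+-monoˡ-≤ (ℚ.- r) le) (ℚ.≤-reflexive (solve 2 (λ q r → q :+ r :- r := q) refl q r))

p<q⇒0<q-p : ∀ {p q} → p <ℚ q → 0ℚ <ℚ q - p
p<q⇒0<q-p {p} {q} p<q = subst (_<ℚ q - p) (ℚ.+-inverseʳ p) (ℚ.+-monoˡ-< (ℚ.- p) p<q)

𝟙 : Bool → ℚ
𝟙 b = if b then 1ℚ else 0ℚ

𝟙-∧ : ∀ b c → 𝟙 (b ∧ c) ≡ 𝟙 b * 𝟙 c
𝟙-∧ true  c = sym (ℚ.*-identityˡ (𝟙 c))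
𝟙-∧ false c = sym (ℚ.*-zeroˡ (𝟙 c))

𝟙-nonNeg : ∀ b → 0ℚ ≤ℚ 𝟙 b
𝟙-nonNeg true  = ℚ.nonNegative⁻¹ 1ℚ
𝟙-nonNeg false = ℚ.≤-refl

𝟙-guard : ∀ b {r s} → (b ≡ true → r ≡ s) → 𝟙 b * r ≡ 𝟙 b * s
𝟙-guard true  r≡s = cong (1ℚ *_) (r≡s refl)
𝟙-guard false {r} {s} r≡s = trans (ℚ.*-zeroˡ r) (sym (ℚ.*-zeroˡ s))

∑-allFin-δ : (k : ℕ) (f : Fin k → ℚ) (i : Fin k) → ∑ (allFin k) (λ j → 𝟙 ⌊ i Fin.≟ j ⌋ * f j) ≡ f i
∑-allFin-δ k f i = trans (∑-allFin-single k _ i off-diagonal) (trans (cong (λ b → 𝟙 b * f i) (≟-refl Fin._≟_ i)) (ℚ.*-identityˡ (f i)))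
  where
  off-diagonal : ∀ j → j ≢ i → 𝟙 ⌊ i Fin.≟ j ⌋ * f j ≡ 0ℚ
  off-diagonal j j≢i = trans (cong (λ b → 𝟙 b * f j) (≟-≢ Fin._≟_ (≢-sym j≢i))) (ℚ.*-zeroˡ (f j))

count : {X : Set} → List X → (X → Bool) → ℕ
count L f = foldr ℕ._+_ 0 (map (λ z → if f z then 1 else 0) L)

module _ {X : Set} where

  ∑-𝟙 : (L : List X) (f : X → Bool) → ∑ L (λ u → 𝟙 (f u)) ≡ fromℕ (count L f)
  ∑-𝟙 []      f = refl
  ∑-𝟙 (x ∷ L) f with f x
  ... | true  = trans (cong (1ℚ +_) (∑-𝟙 L f)) (sym (fromℕ-suc (count L f)))
  ... | false = trans (ℚ.+-identityˡ _) (∑-𝟙 L f)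

  count-≥1 : (L : List X) (f : X → Bool) {z : X} → z ∈ L → f z ≡ true → 1 ≤ count L f
  count-≥1 (x ∷ L) f (here refl) fz rewrite fz = s≤s z≤n
  count-≥1 (x ∷ L) f (there z∈L) fz = ℕ.≤-trans (count-≥1 L f z∈L fz) (ℕ.m≤n+m _ (if f x then 1 else 0))

  count-≥2 : (L : List X) (f : X → Bool) {z₁ z₂ : X} → z₁ ∈ L → z₂ ∈ L → z₁ ≢ z₂ →
             f z₁ ≡ true → f z₂ ≡ true → 2 ≤ count L f
  count-≥2 (x ∷ L) f (here refl) (here refl) z₁≢z₂ _ _ = ⊥-elim (z₁≢z₂ refl)
  count-≥2 (x ∷ L) f (here refl) (there z₂∈L) _ fz₁ fz₂ rewrite fz₁ = s≤s (count-≥1 L f z₂∈L fz₂)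
  count-≥2 (x ∷ L) f (there z₁∈L) (here refl) _ fz₁ fz₂ rewrite fz₂ = s≤s (count-≥1 L f z₁∈L fz₁)
  count-≥2 (x ∷ L) f (there z₁∈L) (there z₂∈L) z₁≢z₂ fz₁ fz₂ =
    ℕ.≤-trans (count-≥2 L f z₁∈L z₂∈L z₁≢z₂ fz₁ fz₂) (ℕ.m≤n+m _ (if f x then 1 else 0))

-- Finite graphs: distances, W₁ and curvature

module _ (G : FinGraph) where
  open FinGraph G

  coupling-potential : ∀ {μ ν π} → Coupling G μ ν π → (f : V → ℚ) →
    ∑ elems (λ u → ∑ elems (λ v → π u v * (f u - f v))) ≡ ∑ elems (λ u → f u * μ u) - ∑ elems (λ v → f v * ν v)
  coupling-potential {μ} {ν} {π} (_ , rows , cols) f = begin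
    ∑ elems (λ u → ∑ elems (λ v → π u v * (f u - f v)))
      ≡⟨ ∑-cong elems (λ u → trans (∑-cong elems (λ v → split (π u v) (f u) (f v))) (∑-distrib-sub elems _ _)) ⟩
    ∑ elems (λ u → ∑ elems (λ v → f u * π u v) - ∑ elems (λ v → f v * π u v))
      ≡⟨ ∑-distrib-sub elems _ _ ⟩
    ∑ elems (λ u → ∑ elems (λ v → f u * π u v)) - ∑ elems (λ u → ∑ elems (λ v → f v * π u v))
      ≡⟨ cong₂ _-_ (∑-cong elems (λ u → trans (*-distribˡ-∑ elems (f u) (π u)) (cong (f u *_) (rows u))))
                   (trans (∑-comm elems elems (λ u v → f v * π u v))
                          (∑-cong elems (λ v → trans (*-distribˡ-∑ elems (f v) (λ u → π u v)) (cong (f v *_) (cols v))))) ⟩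
    ∑ elems (λ u → f u * μ u) - ∑ elems (λ v → f v * ν v) ∎
    where
    open ≡-Reasoning
    split : ∀ r s t → r * (s - t) ≡ s * r - t * r
    split = solve 3 (λ r s t → r :* (s :- t) := s :* r :- t :* r) refl

  -- Weak duality: ∑∑ σ (f u - f v) is the same for every coupling σ, so a 1-Lipschitz f that is tight on
  -- the support of π makes π optimal.
  isW1-byPotential : ∀ {μ ν π} (f : V → ℚ) → Coupling G μ ν π →
    (∀ u v → f u - f v ≤ℚ fromℕ (dist G u v)) →
    (∀ u v → π u v * (f u - f v) ≡ π u v * fromℕ (dist G u v)) →
    IsW1 G μ ν (cost G π)
  isW1-byPotential {μ} {ν} {π} f π-coupling lipschitz tight = (π , π-coupling , refl) , optimal
    where
    optimal : ∀ σ → Coupling G μ ν σ → cost G π ≤ℚ cost G σ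
    optimal σ σ-coupling@(σ≥0 , _) = begin
      cost G π
        ≡⟨ ∑-cong elems (λ u → ∑-cong elems (λ v → sym (tight u v))) ⟩
      ∑ elems (λ u → ∑ elems (λ v → π u v * (f u - f v)))
        ≡⟨ trans (coupling-potential π-coupling f) (sym (coupling-potential σ-coupling f)) ⟩
      ∑ elems (λ u → ∑ elems (λ v → σ u v * (f u - f v)))
        ≤⟨ ∑-mono-≤ elems (λ u → ∑-mono-≤ elems (λ v →
             ℚ.*-monoˡ-≤-nonNeg (σ u v) {{ℚ.nonNegative (σ≥0 u v)}} (lipschitz u v))) ⟩
      cost G σ ∎
      where open ℚ.≤-Reasoning

  isKappaP-adjacent : ∀ {p x y w k} → dist G x y ≡ 1 →
    IsW1 G (lazyMeasure G p x) (lazyMeasure G p y) w → k ≡ 1ℚ - w → IsKappaP G p x y k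
  isKappaP-adjacent {k = k} d≡1 w₁ k≡1-w rewrite d≡1 = _ , w₁ , trans (ℚ.*-identityʳ k) k≡1-w

  isLLYCurvature-byExactκₚ : ∀ {x y} K → (∀ p → ½ <ℚ p → p <ℚ 1ℚ → IsKappaP G p x y (K * (1ℚ - p))) →
    IsLLYCurvature G x y K
  isLLYCurvature-byExactκₚ K exact ε ε>0 = ½ , ℚ.positive⁻¹ ½ , within
    where
    within : ∀ p → 0ℚ ≤ℚ p → 1ℚ - ½ <ℚ p → p <ℚ 1ℚ →
             Σ ℚ λ k → IsKappaP G p _ _ k × ∣ k - K * (1ℚ - p) ∣ <ℚ ε * (1ℚ - p)
    within p _ ½<p p<1 = K * (1ℚ - p) , exact p ½<p p<1 , error<bound
      where
      error<bound : ∣ K * (1ℚ - p) - K * (1ℚ - p) ∣ <ℚ ε * (1ℚ - p)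
      error<bound rewrite ℚ.+-inverseʳ (K * (1ℚ - p)) =
        ℚ.positive⁻¹ _ {{ℚ.pos*pos⇒pos ε {{ℚ.positive ε>0}} (1ℚ - p) {{ℚ.positive (p<q⇒0<q-p p<1)}}}}

module Distances (G : FinGraph) (complete : ∀ v → v ∈ FinGraph.elems G) where
  open FinGraph G

  private
    reach-1 : ∀ {u v} → adj u v ≡ true → reach G 1 u v ≡ true
    reach-1 {u} {v} uv = trans (cong (⌊ u ≟V v ⌋ ∨_) (any-true elems _ (complete u) (trans (cong (_∧ adj u v) (≟-refl _≟V_ u)) uv)))
                               (𝔹.∨-zeroʳ _)

    reach-2 : ∀ {u w v} → adj u w ≡ true → adj w v ≡ true → reach G 2 u v ≡ true
    reach-2 {u} {w} {v} uw wv = trans (cong (reach G 1 u v ∨_) (any-true elems _ (complete w) (trans (cong (_∧ adj w v) (reach-1 uw)) wv)))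
                                      (𝔹.∨-zeroʳ _)

    reach-1-false : ∀ {u v} → u ≢ v → adj u v ≡ false → reach G 1 u v ≡ false
    reach-1-false {u} {v} u≢v ¬uv rewrite ≟-≢ _≟V_ u≢v = any-false elems _ not-via
      where
      not-via : ∀ z → ⌊ u ≟V z ⌋ ∧ adj z v ≡ false
      not-via z with u ≟V z
      ... | yes refl = ¬uv
      ... | no _     = refl

    firstReach-≥ : ∀ f k u v → k ≤ firstReach G f k u v
    firstReach-≥ zero    k u v = ℕ.≤-refl
    firstReach-≥ (suc f) k u v with reach G k u v
    ... | true  = ℕ.≤-refl
    ... | false = ℕ.<⇒≤ (firstReach-≥ f (suc k) u v)

    firstReach-reached : ∀ f k {u v} → reach G k u v ≡ true → firstReach G f k u v ≡ k
    firstReach-reached zero    k r = refl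
    firstReach-reached (suc f) k r rewrite r = refl

    firstReach-missed : ∀ f k {u v} → reach G k u v ≡ false → firstReach G (suc f) k u v ≡ firstReach G f (suc k) u v
    firstReach-missed f k r rewrite r = refl

    firstReach-from-1 : ∀ f {u v} → u ≢ v → firstReach G (suc f) 0 u v ≡ firstReach G f 1 u v
    firstReach-from-1 f u≢v = firstReach-missed f 0 (≟-≢ _≟V_ u≢v)

    dist-unfold : ∀ {u v} → u ≢ v → Σ ℕ λ f → dist G u v ≡ firstReach G (suc (suc f)) 0 u v
    dist-unfold {u} {v} u≢v = unfold (length-≥2 (complete u) (complete v) u≢v)
      where
      unfold : ∀ {l} → 2 ≤ l → Σ ℕ λ f → firstReach G l 0 u v ≡ firstReach G (suc (suc f)) 0 u v
      unfold (s≤s (s≤s {n = f} _)) = f , refl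

  dist-refl : ∀ u → dist G u u ≡ 0
  dist-refl u = firstReach-reached (length elems) 0 (≟-refl _≟V_ u)

  dist-adjacent : ∀ {u v} → u ≢ v → adj u v ≡ true → dist G u v ≡ 1
  dist-adjacent u≢v uv with dist-unfold u≢v
  ... | f , eq = trans eq (trans (firstReach-from-1 (suc f) u≢v) (firstReach-reached (suc f) 1 (reach-1 uv)))

  dist-viaCommonNeighbour : ∀ {u w v} → u ≢ v → adj u v ≡ false → adj u w ≡ true → adj w v ≡ true → dist G u v ≡ 2
  dist-viaCommonNeighbour u≢v ¬uv uw wv with dist-unfold u≢v
  ... | f , eq = trans eq (trans (firstReach-from-1 (suc f) u≢v)
                          (trans (firstReach-missed f 1 (reach-1-false u≢v ¬uv)) (firstReach-reached f 2 (reach-2 uw wv))))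

  dist-≥1 : ∀ {u v} → u ≢ v → 1 ≤ dist G u v
  dist-≥1 {u} {v} u≢v with dist-unfold u≢v
  ... | f , eq = subst (1 ≤_) (sym (trans eq (firstReach-from-1 (suc f) u≢v))) (firstReach-≥ (suc f) 1 u v)

  dist-≥2 : ∀ {u v} → u ≢ v → adj u v ≡ false → 2 ≤ dist G u v
  dist-≥2 {u} {v} u≢v ¬uv with dist-unfold u≢v
  ... | f , eq = subst (2 ≤_) (sym (trans eq (trans (firstReach-from-1 (suc f) u≢v) (firstReach-missed f 1 (reach-1-false u≢v ¬uv)))))
                       (firstReach-≥ f 2 u v)

-- Line graphs

module LineGraphOf {n : ℕ} (A : Fin n → Fin n → Bool)
                   (symmetric : ∀ x y → A x y ≡ A y x) (irreflexive : ∀ x → A x x ≡ false) where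

  _≟ₑ_ : DecidableEquality (Edge A)
  _≟ₑ_ = _≟E_ A

  end₁ end₂ : Edge A → Fin n
  end₁ ((s , _) , _) = s
  end₂ ((_ , t) , _) = t

  ends-ordered : ∀ e → toℕ (end₁ e) ℕ.< toℕ (end₂ e)
  ends-ordered ((s , t) , st) = ℕ.<ᵇ⇒< (toℕ s) (toℕ t) (proj₁ (Equivalence.to 𝔹.T-∧ st))

  ends-adjacent : ∀ e → A (end₁ e) (end₂ e) ≡ true
  ends-adjacent ((s , t) , st) = Equivalence.to 𝔹.T-≡ (proj₂ (Equivalence.to (𝔹.T-∧ {toℕ s ℕ.<ᵇ toℕ t}) st))

  Edge-≡ : ∀ {e e′} → end₁ e ≡ end₁ e′ → end₂ e ≡ end₂ e′ → e ≡ e′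
  Edge-≡ {(s , t) , st} {(.s , .t) , st′} refl refl = cong (λ pf → (s , t) , pf) (𝔹.T-irrelevant st st′)

  incident : Fin n → Edge A → Bool
  incident v e = ⌊ v Fin.≟ end₁ e ⌋ ∨ ⌊ v Fin.≟ end₂ e ⌋

  incident-end₁ : ∀ e → incident (end₁ e) e ≡ true
  incident-end₁ e rewrite ≟-refl Fin._≟_ (end₁ e) = refl

  incident-end₂ : ∀ e → incident (end₂ e) e ≡ true
  incident-end₂ e rewrite ≟-refl Fin._≟_ (end₂ e) = 𝔹.∨-zeroʳ _

  incident⇒end : ∀ {v e} → incident v e ≡ true → v ≡ end₁ e ⊎ v ≡ end₂ e
  incident⇒end {v} {e} v∈e with v Fin.≟ end₁ e | v Fin.≟ end₂ e
  incident⇒end _  | yes v≡s | _       = inj₁ v≡s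
  incident⇒end _  | no _    | yes v≡t = inj₂ v≡t
  incident⇒end () | no _    | no _

  record Joins (e : Edge A) (s t : Fin n) : Set where
    constructor joins
    field
      incident₁ : incident s e ≡ true
      incident₂ : incident t e ≡ true
      distinct  : s ≢ t

  endpoints : ∀ {s t e} → Joins e s t → (s ≡ end₁ e × t ≡ end₂ e) ⊎ (s ≡ end₂ e × t ≡ end₁ e)
  endpoints {s} {t} {e} (joins s∈e t∈e s≢t) with incident⇒end {s} {e} s∈e | incident⇒end {t} {e} t∈e
  ... | inj₁ s≡ | inj₁ t≡ = ⊥-elim (s≢t (trans s≡ (sym t≡)))
  ... | inj₁ s≡ | inj₂ t≡ = inj₁ (s≡ , t≡)
  ... | inj₂ s≡ | inj₁ t≡ = inj₂ (s≡ , t≡)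
  ... | inj₂ s≡ | inj₂ t≡ = ⊥-elim (s≢t (trans s≡ (sym t≡)))

  endpoints-adjacent : ∀ {s t e} → Joins e s t → A s t ≡ true
  endpoints-adjacent {e = e} st with endpoints st
  ... | inj₁ (refl , refl) = ends-adjacent e
  ... | inj₂ (refl , refl) = trans (symmetric _ _) (ends-adjacent e)

  endpoints-determine : ∀ {s t e e′} → Joins e s t → Joins e′ s t → e ≡ e′
  endpoints-determine {e = e} {e′} st st′ with endpoints st | endpoints st′
  ... | inj₁ (s≡ , t≡) | inj₁ (s≡′ , t≡′) = Edge-≡ (trans (sym s≡) s≡′) (trans (sym t≡) t≡′)
  ... | inj₂ (s≡ , t≡) | inj₂ (s≡′ , t≡′) = Edge-≡ (trans (sym t≡) t≡′) (trans (sym s≡) s≡′)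
  ... | inj₁ (s≡ , t≡) | inj₂ (s≡′ , t≡′) =
    ⊥-elim (ℕ.<-asym (subst₂ ℕ._<_ (cong toℕ (trans (sym s≡) s≡′)) (cong toℕ (trans (sym t≡) t≡′)) (ends-ordered e)) (ends-ordered e′))
  ... | inj₂ (s≡ , t≡) | inj₁ (s≡′ , t≡′) =
    ⊥-elim (ℕ.<-asym (subst₂ ℕ._<_ (cong toℕ (trans (sym t≡) t≡′)) (cong toℕ (trans (sym s≡) s≡′)) (ends-ordered e)) (ends-ordered e′))

  incident-third : ∀ {s t e w} → Joins e s t → w ≢ s → w ≢ t → incident w e ≡ false
  incident-third {w = w} st w≢s w≢t with endpoints st
  ... | inj₁ (refl , refl) rewrite ≟-≢ Fin._≟_ w≢s | ≟-≢ Fin._≟_ w≢t = refl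
  ... | inj₂ (refl , refl) rewrite ≟-≢ Fin._≟_ w≢s | ≟-≢ Fin._≟_ w≢t = refl

  end₁≢end₂ : ∀ e → end₁ e ≢ end₂ e
  end₁≢end₂ e eq = ℕ.<-irrefl (cong toℕ eq) (ends-ordered e)

  joins-ends : ∀ e → Joins e (end₁ e) (end₂ e)
  joins-ends e = joins (incident-end₁ e) (incident-end₂ e) (end₁≢end₂ e)

  joins-sym : ∀ {e s t} → Joins e s t → Joins e t s
  joins-sym (joins s∈e t∈e s≢t) = joins t∈e s∈e (≢-sym s≢t)

  ≟ₑ-joins : ∀ {e s t} → Joins e s t → ∀ z → ⌊ z ≟ₑ e ⌋ ≡ incident s z ∧ incident t z
  ≟ₑ-joins {e} {s} {t} st@(joins s∈e t∈e s≢t) z with z ≟ₑ e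
  ... | yes refl rewrite s∈e | t∈e = refl
  ... | no z≢e with incident s z in s∈z | incident t z in t∈z
  ...   | true  | true  = ⊥-elim (z≢e (endpoints-determine (joins s∈z t∈z s≢t) st))
  ...   | true  | false = refl
  ...   | false | _     = refl

  private
    same-ends : ∀ e z → ⌊ end₁ e Fin.≟ end₁ z ⌋ ∧ ⌊ end₂ e Fin.≟ end₂ z ⌋ ≡ ⌊ z ≟ₑ e ⌋
    same-ends e z with z ≟ₑ e
    ... | yes refl rewrite ≟-refl Fin._≟_ (end₁ e) | ≟-refl Fin._≟_ (end₂ e) = refl
    ... | no z≢e with end₁ e Fin.≟ end₁ z | end₂ e Fin.≟ end₂ z
    ...   | yes eq₁ | yes eq₂ = ⊥-elim (z≢e (Edge-≡ (sym eq₁) (sym eq₂)))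
    ...   | yes _   | no _    = refl
    ...   | no _    | _       = refl

  lineAdj-joins : ∀ {e s t} → Joins e s t → ∀ z → lineAdj A e z ≡ incident s z xor incident t z
  lineAdj-joins {e} {s} {t} st z = begin
    lineAdj A e z
      ≡⟨ cong₂ (λ same meet → not same ∧ meet) (same-ends e z) (sym (𝔹.∨-assoc ⌊ end₁ e Fin.≟ end₁ z ⌋ ⌊ end₁ e Fin.≟ end₂ z ⌋ (incident (end₂ e) z))) ⟩
    not ⌊ z ≟ₑ e ⌋ ∧ (incident (end₁ e) z ∨ incident (end₂ e) z)
      ≡⟨ cong₂ (λ same meet → not same ∧ meet) (≟ₑ-joins st z) (ends-∨ (endpoints st)) ⟩
    not (incident s z ∧ incident t z) ∧ (incident s z ∨ incident t z)
      ≡⟨ trans (𝔹.∧-comm (not (incident s z ∧ incident t z)) _) (sym (𝔹.xor-is-ok (incident s z) (incident t z))) ⟩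
    incident s z xor incident t z ∎
    where
    open ≡-Reasoning
    ends-∨ : (s ≡ end₁ e × t ≡ end₂ e) ⊎ (s ≡ end₂ e × t ≡ end₁ e) →
             incident (end₁ e) z ∨ incident (end₂ e) z ≡ incident s z ∨ incident t z
    ends-∨ (inj₁ (refl , refl)) = refl
    ends-∨ (inj₂ (refl , refl)) = 𝔹.∨-comm (incident (end₁ e) z) (incident (end₂ e) z)

  opposite : Fin n → Edge A → Fin n
  opposite v e = if ⌊ v Fin.≟ end₁ e ⌋ then end₂ e else end₁ e

  joins-opposite : ∀ {v e} → incident v e ≡ true → Joins e v (opposite v e)
  joins-opposite {v} {e} v∈e with incident⇒end {v} {e} v∈e
  ... | inj₁ refl rewrite ≟-refl Fin._≟_ (end₁ e) = joins (incident-end₁ e) (incident-end₂ e) (end₁≢end₂ e)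
  ... | inj₂ refl rewrite ≟-≢ Fin._≟_ (≢-sym (end₁≢end₂ e)) = joins (incident-end₂ e) (incident-end₁ e) (≢-sym (end₁≢end₂ e))

  incident-opposite : ∀ {v e w} → incident v e ≡ true → w ≢ v → incident w e ≡ ⌊ w Fin.≟ opposite v e ⌋
  incident-opposite {v} {e} {w} v∈e w≢v with w Fin.≟ opposite v e
  ... | yes refl = Joins.incident₂ (joins-opposite {v} {e} v∈e)
  ... | no w≢v′  = incident-third (joins-opposite {v} {e} v∈e) w≢v w≢v′

  orderedEdge : ∀ {s t} → toℕ s ℕ.< toℕ t → A s t ≡ true → Edge A
  orderedEdge {s} {t} s<t st = (s , t) , subst T (sym (cong₂ _∧_ (<ᵇ-true s<t) st)) tt

  edgeOf : ∀ {s t} → s ≢ t → A s t ≡ true → Σ (Edge A) λ e → Joins e s t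
  edgeOf {s} {t} s≢t st with ℕ.<-cmp (toℕ s) (toℕ t)
  ... | tri< s<t _ _ = let e = orderedEdge s<t st in e , joins (incident-end₁ e) (incident-end₂ e) s≢t
  ... | tri≈ _ s≡t _ = ⊥-elim (s≢t (Fin.toℕ-injective s≡t))
  ... | tri> _ _ t<s = let e = orderedEdge t<s (trans (symmetric t s) st) in e , joins (incident-end₂ e) (incident-end₁ e) s≢t

  toEdge-edge : ∀ e → toEdge A (proj₁ e) ≡ just e
  toEdge-edge ((s , t) , st) with T? (isOrdEdge A (s , t))
  ... | yes st′ = cong (λ pf → just ((s , t) , pf)) (𝔹.T-irrelevant st′ st)
  ... | no ¬st  = ⊥-elim (¬st st)

  edge-∈ : ∀ e → e ∈ edges A
  edge-∈ e = ∈-mapMaybe⁺ (toEdge A) (∈-cartesianProduct⁺ (∈-allFin (end₁ e)) (∈-allFin (end₂ e))) (toEdge-edge e)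

  onPairs : (Edge A → ℚ) → Fin n → Fin n → ℚ
  onPairs h s t = maybe′ h 0ℚ (toEdge A (s , t))

  ∑-edges : ∀ h → ∑ (edges A) h ≡ ∑ (allFin n) (λ s → ∑ (allFin n) (onPairs h s))
  ∑-edges h = trans (∑-mapMaybe (cartesianProduct (allFin n) (allFin n)) (toEdge A) h) (∑-cartesianProduct (allFin n) (allFin n) _)

  onPairs-edge : ∀ h e → onPairs h (end₁ e) (end₂ e) ≡ h e
  onPairs-edge h e = cong (maybe′ h 0ℚ) (toEdge-edge e)

  onPairs-vanish : ∀ (h : Edge A → ℚ) s t → (∀ st → h ((s , t) , st) ≡ 0ℚ) → onPairs h s t ≡ 0ℚ
  onPairs-vanish h s t vanish with T? (isOrdEdge A (s , t))
  ... | yes st = vanish st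
  ... | no _   = refl

  ∑-edges-single : ∀ h e → (∀ u → u ≢ e → h u ≡ 0ℚ) → ∑ (edges A) h ≡ h e
  ∑-edges-single h e vanish = begin
    ∑ (edges A) h
      ≡⟨ ∑-edges h ⟩
    ∑ (allFin n) (λ s → ∑ (allFin n) (onPairs h s))
      ≡⟨ ∑-allFin-single n (λ s → ∑ (allFin n) (onPairs h s)) (end₁ e) off-end₁ ⟩
    ∑ (allFin n) (onPairs h (end₁ e))
      ≡⟨ ∑-allFin-single n (onPairs h (end₁ e)) (end₂ e) off-end₂ ⟩
    onPairs h (end₁ e) (end₂ e)
      ≡⟨ onPairs-edge h e ⟩
    h e ∎
    where
    open ≡-Reasoning
    off-end₁ : ∀ s → s ≢ end₁ e → ∑ (allFin n) (onPairs h s) ≡ 0ℚ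
    off-end₁ s s≢ = ∑-zero (allFin n) (λ t → onPairs-vanish h s t (λ st → vanish ((s , t) , st) (λ eq → s≢ (cong end₁ eq))))
    off-end₂ : ∀ t → t ≢ end₂ e → onPairs h (end₁ e) t ≡ 0ℚ
    off-end₂ t t≢ = onPairs-vanish h (end₁ e) t (λ st → vanish ((end₁ e , t) , st) (λ eq → t≢ (cong end₂ eq)))

  ∑-edges-δ : ∀ e (B : Edge A → Bool) → ∑ (edges A) (λ u → 𝟙 (⌊ u ≟ₑ e ⌋ ∧ B u)) ≡ 𝟙 (B e)
  ∑-edges-δ e B = trans (∑-edges-single (λ u → 𝟙 (⌊ u ≟ₑ e ⌋ ∧ B u)) e off-e) (cong (λ b → 𝟙 (b ∧ B e)) (≟-refl _≟ₑ_ e))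
    where
    off-e : ∀ u → u ≢ e → 𝟙 (⌊ u ≟ₑ e ⌋ ∧ B u) ≡ 0ℚ
    off-e u u≢e = cong (λ b → 𝟙 (b ∧ B u)) (≟-≢ _≟ₑ_ u≢e)

  ∑-edges-δ′ : ∀ e (B : Edge A → Bool) → ∑ (edges A) (λ u → 𝟙 (⌊ e ≟ₑ u ⌋ ∧ B u)) ≡ 𝟙 (B e)
  ∑-edges-δ′ e B = trans (∑-edges-single (λ u → 𝟙 (⌊ e ≟ₑ u ⌋ ∧ B u)) e off-e) (cong (λ b → 𝟙 (b ∧ B e)) (≟-refl _≟ₑ_ e))
    where
    off-e : ∀ u → u ≢ e → 𝟙 (⌊ e ≟ₑ u ⌋ ∧ B u) ≡ 0ℚ
    off-e u u≢e = cong (λ b → 𝟙 (b ∧ B u)) (≟-≢ _≟ₑ_ (≢-sym u≢e))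

  ∑-edges-joins : ∀ {e s t} → Joins e s t → ∑ (edges A) (λ u → 𝟙 (incident s u ∧ incident t u)) ≡ 1ℚ
  ∑-edges-joins {e} {s} {t} st =
    trans (∑-cong (edges A) (λ u → cong 𝟙 (trans (sym (≟ₑ-joins st u)) (sym (𝔹.∧-identityʳ _)))))
          (∑-edges-δ e (λ _ → true))

  private
    incident-split : ∀ v e (g : Fin n → ℚ) →
      𝟙 (incident v e) * g (opposite v e) ≡ 𝟙 ⌊ v Fin.≟ end₁ e ⌋ * g (end₂ e) + 𝟙 ⌊ v Fin.≟ end₂ e ⌋ * g (end₁ e)
    incident-split v e g with v Fin.≟ end₁ e | v Fin.≟ end₂ e
    ... | yes refl | yes v≡t = ⊥-elim (end₁≢end₂ e v≡t)
    ... | yes _    | no _    = sym (trans (cong (1ℚ * g (end₂ e) +_) (ℚ.*-zeroˡ (g (end₁ e)))) (ℚ.+-identityʳ _))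
    ... | no _     | yes _   = sym (trans (cong (_+ 1ℚ * g (end₁ e)) (ℚ.*-zeroˡ (g (end₂ e)))) (ℚ.+-identityˡ _))
    ... | no _     | no _    = trans (ℚ.*-zeroˡ (g (end₁ e))) (sym (cong₂ _+_ (ℚ.*-zeroˡ (g (end₂ e))) (ℚ.*-zeroˡ (g (end₁ e)))))

    onPairs-incident : ∀ v (g : Fin n → ℚ) s t →
      onPairs (λ u → 𝟙 (incident v u) * g (opposite v u)) s t ≡
      𝟙 ⌊ v Fin.≟ s ⌋ * (𝟙 (isOrdEdge A (s , t)) * g t) + 𝟙 ⌊ v Fin.≟ t ⌋ * (𝟙 (isOrdEdge A (s , t)) * g s)
    onPairs-incident v g s t with T? (isOrdEdge A (s , t))
    ... | yes st rewrite Equivalence.to 𝔹.T-≡ st | ℚ.*-identityˡ (g t) | ℚ.*-identityˡ (g s) = incident-split v ((s , t) , st) g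
    ... | no ¬st rewrite ¬T⇒≡false ¬st | ℚ.*-zeroˡ (g t) | ℚ.*-zeroˡ (g s)
                       | ℚ.*-zeroʳ (𝟙 ⌊ v Fin.≟ s ⌋) | ℚ.*-zeroʳ (𝟙 ⌊ v Fin.≟ t ⌋) = refl

    ordered-split : ∀ v w → 𝟙 (isOrdEdge A (v , w)) + 𝟙 (isOrdEdge A (w , v)) ≡ 𝟙 (A v w)
    ordered-split v w with ℕ.<-cmp (toℕ v) (toℕ w)
    ... | tri< v<w _ w≮v rewrite <ᵇ-true v<w | <ᵇ-false w≮v = ℚ.+-identityʳ _
    ... | tri> v≮w _ w<v rewrite <ᵇ-false v≮w | <ᵇ-true w<v | symmetric w v = ℚ.+-identityˡ _
    ... | tri≈ _ v≡w _ rewrite Fin.toℕ-injective v≡w | irreflexive w | 𝔹.∧-zeroʳ (toℕ w ℕ.<ᵇ toℕ w) = refl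

  ∑-edges-incident : ∀ v (g : Fin n → ℚ) →
    ∑ (edges A) (λ u → 𝟙 (incident v u) * g (opposite v u)) ≡ ∑ (allFin n) (λ w → 𝟙 (A v w) * g w)
  ∑-edges-incident v g = begin
    ∑ (edges A) (λ u → 𝟙 (incident v u) * g (opposite v u))
      ≡⟨ ∑-edges _ ⟩
    ∑ F (λ s → ∑ F (onPairs (λ u → 𝟙 (incident v u) * g (opposite v u)) s))
      ≡⟨ ∑-cong F (λ s → trans (∑-cong F (onPairs-incident v g s)) (∑-distrib-+ F (λ t → 𝟙 ⌊ v Fin.≟ s ⌋ * P s t) (Q s))) ⟩
    ∑ F (λ s → ∑ F (λ t → 𝟙 ⌊ v Fin.≟ s ⌋ * P s t) + ∑ F (Q s))
      ≡⟨ ∑-cong F (λ s → cong₂ _+_ (*-distribˡ-∑ F (𝟙 ⌊ v Fin.≟ s ⌋) (P s)) (∑-allFin-δ n (λ t → 𝟙 (isOrdEdge A (s , t)) * g s) v)) ⟩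
    ∑ F (λ s → 𝟙 ⌊ v Fin.≟ s ⌋ * ∑ F (P s) + P′ s)
      ≡⟨ ∑-distrib-+ F (λ s → 𝟙 ⌊ v Fin.≟ s ⌋ * ∑ F (P s)) P′ ⟩
    ∑ F (λ s → 𝟙 ⌊ v Fin.≟ s ⌋ * ∑ F (P s)) + ∑ F P′
      ≡⟨ cong (_+ ∑ F P′) (∑-allFin-δ n (λ s → ∑ F (P s)) v) ⟩
    ∑ F (P v) + ∑ F P′
      ≡⟨ sym (∑-distrib-+ F (P v) P′) ⟩
    ∑ F (λ w → P v w + P′ w)
      ≡⟨ ∑-cong F (λ w → trans (sym (ℚ.*-distribʳ-+ (g w) (𝟙 (isOrdEdge A (v , w))) (𝟙 (isOrdEdge A (w , v)))))
                                (cong (_* g w) (ordered-split v w))) ⟩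
    ∑ F (λ w → 𝟙 (A v w) * g w) ∎
    where
    open ≡-Reasoning
    F = allFin n
    P Q : Fin n → Fin n → ℚ
    P s t = 𝟙 (isOrdEdge A (s , t)) * g t
    Q s t = 𝟙 ⌊ v Fin.≟ t ⌋ * (𝟙 (isOrdEdge A (s , t)) * g s)
    P′ : Fin n → ℚ
    P′ s = 𝟙 (isOrdEdge A (s , v)) * g s

  adjacent⇒≢ : ∀ {u v} → A u v ≡ true → u ≢ v
  adjacent⇒≢ {u} uv refl = 𝔹.not-¬ (irreflexive u) uv

  spoke : Fin n → Fin n → Edge A → Bool
  spoke s t u = incident s u ∧ not (incident t u)

  lazyMeasure-joins : ∀ {e s t} → Joins e s t → ∀ p u →
    lazyMeasure (LineGraph A) p e u ≡
    (if incident s u ∧ incident t u then p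
     else if incident s u xor incident t u then (1ℚ - p) * invℕ (degree (LineGraph A) e) else 0ℚ)
  lazyMeasure-joins {e} st p u =
    cong₂ (λ same meet → if same then p else if meet then (1ℚ - p) * invℕ (degree (LineGraph A) e) else 0ℚ)
          (≟ₑ-joins st u) (lineAdj-joins st u)

  module Regular {d : ℕ} (regular : ∀ v → countFin (A v) ≡ d) where

    ∑-incident : ∀ v → ∑ (edges A) (λ u → 𝟙 (incident v u)) ≡ fromℕ d
    ∑-incident v = begin
      ∑ (edges A) (λ u → 𝟙 (incident v u))               ≡⟨ ∑-cong (edges A) (λ u → sym (ℚ.*-identityʳ _)) ⟩
      ∑ (edges A) (λ u → 𝟙 (incident v u) * 1ℚ)          ≡⟨ ∑-edges-incident v (λ _ → 1ℚ) ⟩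
      ∑ (allFin n) (λ w → 𝟙 (A v w) * 1ℚ)                ≡⟨ ∑-cong (allFin n) (λ w → ℚ.*-identityʳ _) ⟩
      ∑ (allFin n) (λ w → 𝟙 (A v w))                     ≡⟨ ∑-𝟙 (allFin n) (A v) ⟩
      fromℕ (countFin (A v))                             ≡⟨ cong fromℕ (regular v) ⟩
      fromℕ d                                            ∎
      where open ≡-Reasoning

    lineGraph-degree : ∀ {e s t} → Joins e s t → degree (LineGraph A) e ≡ 2 ℕ.* d ∸ 2
    lineGraph-degree {e} {s} {t} st = fromℕ-injective (begin
      fromℕ (degree (LineGraph A) e)
        ≡⟨ sym (∑-𝟙 (edges A) (lineAdj A e)) ⟩
      ∑ (edges A) (λ z → 𝟙 (lineAdj A e z))
        ≡⟨ ∑-cong (edges A) (λ z → trans (cong 𝟙 (lineAdj-joins st z)) (𝟙-xor (incident s z) (incident t z))) ⟩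
      ∑ (edges A) (λ z → 𝟙 (incident s z) + 𝟙 (incident t z) - fromℕ 2 * 𝟙 (incident s z ∧ incident t z))
        ≡⟨ trans (∑-distrib-sub (edges A) _ _) (cong₂ _-_ (∑-distrib-+ (edges A) _ _) (*-distribˡ-∑ (edges A) (fromℕ 2) _)) ⟩
      ∑ (edges A) (λ z → 𝟙 (incident s z)) + ∑ (edges A) (λ z → 𝟙 (incident t z))
        - fromℕ 2 * ∑ (edges A) (λ z → 𝟙 (incident s z ∧ incident t z))
        ≡⟨ cong₂ (λ a b → a - fromℕ 2 * b) (cong₂ _+_ (∑-incident s) (∑-incident t)) (∑-edges-joins st) ⟩
      fromℕ d + fromℕ d - fromℕ 2 * 1ℚ
        ≡⟨ cong (λ z → fromℕ d + fromℕ d - z) (ℚ.*-identityʳ (fromℕ 2)) ⟩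
      fromℕ d + fromℕ d - fromℕ 2
        ≡⟨ sym (fromℕ-2*d∸2 d d≥1) ⟩
      fromℕ (2 ℕ.* d ∸ 2) ∎)
      where
      open ≡-Reasoning
      𝟙-xor : ∀ α β → 𝟙 (α xor β) ≡ 𝟙 α + 𝟙 β - fromℕ 2 * 𝟙 (α ∧ β)
      𝟙-xor true  true  = refl
      𝟙-xor true  false = refl
      𝟙-xor false true  = refl
      𝟙-xor false false = refl
      d≥1 : 1 ≤ d
      d≥1 = subst (1 ≤_) (regular s) (count-≥1 (allFin n) (A s) (∈-allFin t) (endpoints-adjacent st))

    ∑-spokes : ∀ {e s t} → Joins e s t → ∑ (edges A) (λ u → 𝟙 (spoke s t u)) ≡ fromℕ d - 1ℚ
    ∑-spokes {e} {s} {t} st = begin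
      ∑ (edges A) (λ u → 𝟙 (spoke s t u))
        ≡⟨ ∑-cong (edges A) (λ u → 𝟙-∧-not (incident s u) (incident t u)) ⟩
      ∑ (edges A) (λ u → 𝟙 (incident s u) - 𝟙 (incident s u ∧ incident t u))
        ≡⟨ ∑-distrib-sub (edges A) _ _ ⟩
      ∑ (edges A) (λ u → 𝟙 (incident s u)) - ∑ (edges A) (λ u → 𝟙 (incident s u ∧ incident t u))
        ≡⟨ cong₂ _-_ (∑-incident s) (∑-edges-joins st) ⟩
      fromℕ d - 1ℚ ∎
      where
      open ≡-Reasoning
      𝟙-∧-not : ∀ α β → 𝟙 (α ∧ not β) ≡ 𝟙 α - 𝟙 (α ∧ β)
      𝟙-∧-not true  true  = refl
      𝟙-∧-not true  false = refl
      𝟙-∧-not false β     = refl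

-- Moore graphs: strongly regular graphs with parameters (n, d, 0, 1)

module MooreGraph {n d : ℕ} {A : Fin n → Fin n → Bool} (srg : IsSRG n A d 0 1) where
  open IsSRG srg
  open LineGraphOf A symmetric irreflexive
  open Regular regular

  triangle-free : ∀ {u v w} → A u v ≡ true → A u w ≡ true → A v w ≡ false
  triangle-free {u} {v} {w} uv uw with A v w in vw
  ... | false = refl
  ... | true  with () ← subst (1 ≤_) (adjCommon u v uv)
                               (count-≥1 (allFin n) (λ z → A u z ∧ A v z) (∈-allFin w) (cong₂ _∧_ uw vw))

  common-neighbour-unique : ∀ {u v w w′} → u ≢ v → A u v ≡ false →
    A u w ≡ true → A v w ≡ true → A u w′ ≡ true → A v w′ ≡ true → w ≡ w′
  common-neighbour-unique {u} {v} {w} {w′} u≢v ¬uv uw vw uw′ vw′ with w Fin.≟ w′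
  ... | yes w≡w′ = w≡w′
  ... | no w≢w′  with s≤s () ← subst (2 ≤_) (nonAdjCommon u v u≢v ¬uv)
                                 (count-≥2 (allFin n) (λ z → A u z ∧ A v z) (∈-allFin w) (∈-allFin w′) w≢w′
                                           (cong₂ _∧_ uw vw) (cong₂ _∧_ uw′ vw′))

  ∑-common-neighbours : ∀ {u v} → u ≢ v → A u v ≡ false → ∑ (allFin n) (λ w → 𝟙 (A u w ∧ A v w)) ≡ 1ℚ
  ∑-common-neighbours {u} {v} u≢v ¬uv = trans (∑-𝟙 (allFin n) (λ w → A u w ∧ A v w)) (cong fromℕ (nonAdjCommon u v u≢v ¬uv))

  -- Along a path s – b – t, each spoke of s avoiding b is matched with exactly one spoke of t avoiding b:
  -- the one whose far end is the unique common neighbour of t and the far end of the first.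
  ∑-partners : ∀ {s b t u} → A b s ≡ true → A b t ≡ true → s ≢ t → spoke s b u ≡ true →
               ∑ (edges A) (λ v → 𝟙 (spoke t b v ∧ A (opposite s u) (opposite t v))) ≡ 1ℚ
  ∑-partners {s} {b} {t} {u} bs bt s≢t sb∈u = begin
    ∑ (edges A) (λ v → 𝟙 (spoke t b v ∧ A s′ (opposite t v)))
      ≡⟨ ∑-cong (edges A) via-t ⟩
    ∑ (edges A) (λ v → 𝟙 (incident t v) * g (opposite t v))
      ≡⟨ ∑-edges-incident t g ⟩
    ∑ (allFin n) (λ w → 𝟙 (A t w) * g w)
      ≡⟨ ∑-cong (allFin n) (λ w → trans (sym (𝟙-∧ (A t w) _)) (cong 𝟙 (drop-b w))) ⟩
    ∑ (allFin n) (λ w → 𝟙 (A t w ∧ A s′ w))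
      ≡⟨ ∑-common-neighbours t≢s′ ¬ts′ ⟩
    1ℚ ∎
    where
    open ≡-Reasoning
    s′ : Fin n
    s′ = opposite s u
    ss′-joins : Joins u s s′
    ss′-joins = joins-opposite {s} {u} (proj₁ (∧-true sb∈u))
    ss′ : A s s′ ≡ true
    ss′ = endpoints-adjacent ss′-joins
    s′≢b : s′ ≢ b
    s′≢b s′≡b = 𝔹.not-¬ (not-true (proj₂ (∧-true sb∈u))) (subst (λ z → incident z u ≡ true) s′≡b (Joins.incident₂ ss′-joins))

    g : Fin n → ℚ
    g w = 𝟙 (not ⌊ b Fin.≟ w ⌋ ∧ A s′ w)

    via-t : ∀ v → 𝟙 (spoke t b v ∧ A s′ (opposite t v)) ≡ 𝟙 (incident t v) * g (opposite t v)
    via-t v = trans (cong 𝟙 (𝔹.∧-assoc (incident t v) (not (incident b v)) _))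
                    (trans (𝟙-∧ (incident t v) _)
                           (𝟙-guard (incident t v) (λ t∈v → cong (λ z → 𝟙 (not z ∧ A s′ (opposite t v)))
                                                               (incident-opposite {t} {v} t∈v (adjacent⇒≢ bt)))))

    ¬s′b : A s′ b ≡ false
    ¬s′b = triangle-free ss′ (trans (symmetric s b) bs)

    drop-b : ∀ w → A t w ∧ (not ⌊ b Fin.≟ w ⌋ ∧ A s′ w) ≡ A t w ∧ A s′ w
    drop-b w with b Fin.≟ w
    ... | yes refl rewrite ¬s′b = refl
    ... | no _     = refl

    ¬st : A s t ≡ false
    ¬st = triangle-free bs bt

    t≢s′ : t ≢ s′
    t≢s′ refl = 𝔹.not-¬ ¬st ss′

    ¬ts′ : A t s′ ≡ false
    ¬ts′ with A t s′ in ts′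
    ... | false = refl
    ... | true  = ⊥-elim (s′≢b (common-neighbour-unique s≢t ¬st ss′ ts′ (trans (symmetric s b) bs) (trans (symmetric t b) bt)))

  record Wedge (x y : Edge A) : Set where
    field
      a b c   : Fin n
      x-joins : Joins x a b
      y-joins : Joins y c b
      a∉y     : incident a y ≡ false

  wedge : ∀ {x y} → lineAdj A x y ≡ true → Wedge x y
  wedge {x} {y} x~y = from-xor (trans (sym (lineAdj-joins (joins-ends x) y)) x~y)
    where
    from-xor : incident (end₁ x) y xor incident (end₂ x) y ≡ true → Wedge x y
    from-xor one with incident (end₁ x) y in e₁∈y | incident (end₂ x) y in e₂∈y
    from-xor _  | true  | false = record
      { a = end₂ x ; b = end₁ x ; c = opposite (end₁ x) y
      ; x-joins = joins-sym (joins-ends x) ; y-joins = joins-sym (joins-opposite {end₁ x} {y} e₁∈y) ; a∉y = e₂∈y }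
    from-xor _  | false | true  = record
      { a = end₁ x ; b = end₂ x ; c = opposite (end₂ x) y
      ; x-joins = joins-ends x ; y-joins = joins-sym (joins-opposite {end₂ x} {y} e₂∈y) ; a∉y = e₁∈y }
    from-xor () | true  | true
    from-xor () | false | false

  module WedgeTransport {x y : Edge A} (W : Wedge x y) where
    open Wedge W
    open Distances (LineGraph A) edge-∈

    ab : A a b ≡ true
    ab = endpoints-adjacent x-joins

    cb : A c b ≡ true
    cb = endpoints-adjacent y-joins

    a≢c : a ≢ c
    a≢c refl = 𝔹.not-¬ a∉y (Joins.incident₁ y-joins)

    ¬ac : A a c ≡ false
    ¬ac = triangle-free (trans (symmetric b a) ab) (trans (symmetric b c) cb)

    a∈⇒c∉ : ∀ {u} → incident a u ≡ true → incident c u ≡ false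
    a∈⇒c∉ {u} a∈u with incident c u in c∈u
    ... | false = refl
    ... | true  = ⊥-elim (𝔹.not-¬ ¬ac (endpoints-adjacent (joins {u} a∈u c∈u a≢c)))

    spokes-apart : ∀ {u v w} → incident a u ≡ true → spoke c b v ≡ true → incident w u ≡ true → incident w v ≡ false
    spokes-apart {u} {v} {w} a∈u cb∈v w∈u with incident w v in w∈v
    ... | false = refl
    ... | true with w Fin.≟ a | w Fin.≟ c
    ...   | yes refl | _        = ⊥-elim (𝔹.not-¬ (a∈⇒c∉ {v} w∈v) (proj₁ (∧-true cb∈v)))
    ...   | no _     | yes refl = ⊥-elim (𝔹.not-¬ (a∈⇒c∉ {u} a∈u) w∈u)
    ...   | no w≢a   | no w≢c   = ⊥-elim (𝔹.not-¬ (not-true (proj₂ (∧-true cb∈v))) (subst (λ z → incident z v ≡ true) w≡b w∈v))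
      where
      w≡b : w ≡ b
      w≡b = common-neighbour-unique a≢c ¬ac (endpoints-adjacent (joins {u} a∈u w∈u (≢-sym w≢a)))
                                            (endpoints-adjacent (joins {v} (proj₁ (∧-true cb∈v)) w∈v (≢-sym w≢c)))
                                            ab cb

    spokes-nonadjacent : ∀ {u v} → incident a u ≡ true → spoke c b v ≡ true → lineAdj A u v ≡ false
    spokes-nonadjacent {u} {v} a∈u cb∈v =
      trans (lineAdj-joins (joins-ends u) v)
            (cong₂ _xor_ (spokes-apart {u} {v} {end₁ u} a∈u cb∈v (incident-end₁ u))
                         (spokes-apart {u} {v} {end₂ u} a∈u cb∈v (incident-end₂ u)))

    spokes-distinct : ∀ {u v} → incident a u ≡ true → spoke c b v ≡ true → u ≢ v
    spokes-distinct {u} a∈u cb∈v refl = 𝔹.not-¬ (a∈⇒c∉ {u} a∈u) (proj₁ (∧-true cb∈v))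

    matched : Edge A → Edge A → Bool
    matched u v = (spoke a b u ∧ spoke c b v) ∧ A (opposite a u) (opposite c v)

    matched-dist : ∀ u v → matched u v ≡ true → dist (LineGraph A) u v ≡ 2
    matched-dist u v uv = dist-viaCommonNeighbour {u} {z} {v} (spokes-distinct {u} {v} a∈u cb∈v) (spokes-nonadjacent {u} {v} a∈u cb∈v) u~z z~v
      where
      ab∈u : spoke a b u ≡ true
      ab∈u = proj₁ (∧-true (proj₁ (∧-true {spoke a b u ∧ spoke c b v} uv)))
      cb∈v : spoke c b v ≡ true
      cb∈v = proj₂ (∧-true {spoke a b u} (proj₁ (∧-true {spoke a b u ∧ spoke c b v} uv)))
      a′c′ : A (opposite a u) (opposite c v) ≡ true
      a′c′ = proj₂ (∧-true {spoke a b u ∧ spoke c b v} uv)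
      a∈u : incident a u ≡ true
      a∈u = proj₁ (∧-true ab∈u)
      aa′ : Joins u a (opposite a u)
      aa′ = joins-opposite {a} {u} a∈u
      cc′ : Joins v c (opposite c v)
      cc′ = joins-opposite {c} {v} (proj₁ (∧-true cb∈v))
      z : Edge A
      z = proj₁ (edgeOf (adjacent⇒≢ a′c′) a′c′)
      a′c′-joins : Joins z (opposite a u) (opposite c v)
      a′c′-joins = proj₂ (edgeOf (adjacent⇒≢ a′c′) a′c′)
      a≢c′ : a ≢ opposite c v
      a≢c′ a≡c′ = 𝔹.not-¬ (spokes-apart {u} {v} {a} a∈u cb∈v a∈u) (subst (λ w → incident w v ≡ true) (sym a≡c′) (Joins.incident₂ cc′))
      u~z : lineAdj A u z ≡ true
      u~z = trans (lineAdj-joins aa′ z) (cong₂ _xor_ (incident-third a′c′-joins (Joins.distinct aa′) a≢c′) (Joins.incident₁ a′c′-joins))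
      z~v : lineAdj A z v ≡ true
      z~v = trans (lineAdj-joins a′c′-joins v) (cong₂ _xor_ (spokes-apart {u} {v} {opposite a u} a∈u cb∈v (Joins.incident₂ aa′)) (Joins.incident₂ cc′))

    level : Bool → Bool → Bool → ℕ
    level true  true  _     = 1
    level true  false _     = 0
    level false _     true  = 2
    level false _     false = 1

    potential : Edge A → ℕ
    potential u = level (incident c u) (incident b u) (incident a u)

    private
      level-≤2 : ∀ γ β α → level γ β α ≤ 2
      level-≤2 true  true  _     = s≤s z≤n
      level-≤2 true  false _     = z≤n
      level-≤2 false _     true  = ℕ.≤-refl
      level-≤2 false _     false = s≤s z≤n

      level≡0 : ∀ γ β α → level γ β α ≡ 0 → γ ∧ not β ≡ true
      level≡0 true  false _     _ = refl
      level≡0 true  true  _     ()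
      level≡0 false _     true  ()
      level≡0 false _     false ()

      level≡2 : ∀ γ β α → level γ β α ≡ 2 → α ≡ true
      level≡2 false _     true  _ = refl
      level≡2 false _     false ()
      level≡2 true  true  _     ()
      level≡2 true  false _     ()

    potential-lipschitz : ∀ u v → potential u ≤ dist (LineGraph A) u v ℕ.+ potential v
    potential-lipschitz u v with u ≟ₑ v
    ... | yes refl = ℕ.m≤n+m (potential u) _
    ... | no u≢v with potential v in pv
    ...   | suc k = ℕ.≤-trans (level-≤2 (incident c u) _ _) (ℕ.+-mono-≤ (dist-≥1 u≢v) (s≤s z≤n))
    ...   | zero with potential u in pu
    ...     | zero = z≤n
    ...     | suc zero = subst (1 ≤_) (sym (ℕ.+-identityʳ _)) (dist-≥1 u≢v)
    ...     | suc (suc zero) = subst (2 ≤_) (sym (ℕ.+-identityʳ _)) (dist-≥2 u≢v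
                  (spokes-nonadjacent {u} {v} (level≡2 (incident c u) _ _ pu) (level≡0 (incident c v) _ _ pv)))
    ...     | suc (suc (suc _)) with s≤s (s≤s ()) ← ℕ.≤-trans (ℕ.≤-reflexive (sym pu)) (level-≤2 (incident c u) _ _)

    potential-at-a : ∀ {u} → incident a u ≡ true → potential u ≡ 2
    potential-at-a {u} a∈u rewrite a∈⇒c∉ {u} a∈u | a∈u = refl

    potential-at-c : ∀ {v} → spoke c b v ≡ true → potential v ≡ 0
    potential-at-c {v} cb∈v rewrite proj₁ (∧-true {incident c v} cb∈v) | not-true (proj₂ (∧-true {incident c v} cb∈v)) = refl

    gap : Edge A → Edge A → ℚ
    gap u v = fromℕ (potential u) - fromℕ (potential v)

    gap-lipschitz : ∀ u v → gap u v ≤ℚ fromℕ (dist (LineGraph A) u v)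
    gap-lipschitz u v = p≤q+r⇒p-r≤q (subst (fromℕ (potential u) ≤ℚ_) (fromℕ-+ (dist (LineGraph A) u v) (potential v)) (fromℕ-mono-≤ (potential-lipschitz u v)))

    x~y : lineAdj A x y ≡ true
    x~y = trans (lineAdj-joins x-joins y) (cong₂ _xor_ a∉y (Joins.incident₂ y-joins))

    x≢y : x ≢ y
    x≢y refl = 𝔹.not-¬ a∉y (Joins.incident₁ x-joins)

    stays slides : Edge A → Edge A → Bool
    stays  u v = ⌊ v ≟ₑ u ⌋ ∧ incident b v
    slides u v = ⌊ v ≟ₑ y ⌋ ∧ ⌊ u ≟ₑ x ⌋

    stays-support : ∀ u v → stays u v ≡ true → gap u v ≡ 0ℚ × fromℕ (dist (LineGraph A) u v) ≡ 0ℚ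
    stays-support u v uv = subst (λ w → gap u w ≡ 0ℚ × fromℕ (dist (LineGraph A) u w) ≡ 0ℚ) (sym v≡u)
                                 (ℚ.+-inverseʳ (fromℕ (potential u)) , cong fromℕ (dist-refl u))
      where
      v≡u : v ≡ u
      v≡u = ≟-true _≟ₑ_ (proj₁ (∧-true {⌊ v ≟ₑ u ⌋} uv))

    slides-support : ∀ u v → slides u v ≡ true → gap u v ≡ 1ℚ × fromℕ (dist (LineGraph A) u v) ≡ 1ℚ
    slides-support u v uv = subst₂ (λ u′ v′ → gap u′ v′ ≡ 1ℚ × fromℕ (dist (LineGraph A) u′ v′) ≡ 1ℚ) (sym u≡x) (sym v≡y)
                                   (cong₂ (λ i j → fromℕ i - fromℕ j) (potential-at-a {x} (Joins.incident₁ x-joins)) potential-y ,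
                                    cong fromℕ (dist-adjacent x≢y x~y))
      where
      u≡x : u ≡ x
      u≡x = ≟-true _≟ₑ_ (proj₂ (∧-true {⌊ v ≟ₑ y ⌋} uv))
      v≡y : v ≡ y
      v≡y = ≟-true _≟ₑ_ (proj₁ (∧-true {⌊ v ≟ₑ y ⌋} uv))
      potential-y : potential y ≡ 1
      potential-y rewrite Joins.incident₁ y-joins | Joins.incident₂ y-joins = refl

    matched-support : ∀ u v → matched u v ≡ true → gap u v ≡ fromℕ 2 × fromℕ (dist (LineGraph A) u v) ≡ fromℕ 2
    matched-support u v uv = cong₂ (λ i j → fromℕ i - fromℕ j) (potential-at-a {u} a∈u) (potential-at-c {v} cb∈v) ,
                             cong fromℕ (matched-dist u v uv)
      where
      ab∧cb = proj₁ (∧-true {spoke a b u ∧ spoke c b v} uv)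
      a∈u = proj₁ (∧-true (proj₁ (∧-true {spoke a b u} ab∧cb)))
      cb∈v = proj₂ (∧-true {spoke a b u} ab∧cb)

    D : ℕ
    D = 2 ℕ.* d ∸ 2

    d≥2 : 2 ≤ d
    d≥2 = subst (2 ≤_) (regular b)
                (count-≥2 (allFin n) (A b) (∈-allFin a) (∈-allFin c) a≢c (trans (symmetric b a) ab) (trans (symmetric b c) cb))

    instance
      D-nonZero : NonZero D
      D-nonZero = ℕ.>-nonZero (ℕ.≤-trans (s≤s z≤n) (ℕ.∸-monoˡ-≤ 2 (ℕ.*-monoʳ-≤ 2 d≥2)))

    module Plan (p : ℚ) (½<p : ½ <ℚ p) (p<1 : p <ℚ 1ℚ) where
      m : ℚ
      m = (1ℚ - p) * invℕ D

      profile : Bool → Bool → ℚ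
      profile α β = if α ∧ β then p else if α xor β then m else 0ℚ

      measure-profile : ∀ {e s t} → Joins e s t → ∀ u → lazyMeasure (LineGraph A) p e u ≡ profile (incident s u) (incident t u)
      measure-profile {e} {s} {t} st u =
        trans (lazyMeasure-joins st p u)
              (cong (λ k → if incident s u ∧ incident t u then p else if incident s u xor incident t u then (1ℚ - p) * invℕ k else 0ℚ)
                    (lineGraph-degree st))

      stay slide cross plan : Edge A → Edge A → ℚ
      stay  u v = m * 𝟙 (stays u v)
      slide u v = (p - m) * 𝟙 (slides u v)
      cross u v = m * 𝟙 (matched u v)
      plan  u v = stay u v + slide u v + cross u v

      private
        E : List (Edge A)
        E = edges A

      row-stay : ∀ u → ∑ E (stay u) ≡ m * 𝟙 (incident b u)
      row-stay u = trans (*-distribˡ-∑ E m _) (cong (m *_) (∑-edges-δ u (incident b)))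

      col-stay : ∀ v → ∑ E (λ u → stay u v) ≡ m * 𝟙 (incident b v)
      col-stay v = trans (*-distribˡ-∑ E m _) (cong (m *_) (∑-edges-δ′ v (λ _ → incident b v)))

      row-slide : ∀ u → ∑ E (slide u) ≡ (p - m) * 𝟙 (incident a u ∧ incident b u)
      row-slide u = trans (*-distribˡ-∑ E (p - m) _)
                          (cong ((p - m) *_) (trans (∑-edges-δ y (λ _ → ⌊ u ≟ₑ x ⌋)) (cong 𝟙 (≟ₑ-joins x-joins u))))

      col-slide : ∀ v → ∑ E (λ u → slide u v) ≡ (p - m) * 𝟙 (incident c v ∧ incident b v)
      col-slide v = trans (*-distribˡ-∑ E (p - m) _)
                          (cong ((p - m) *_) (trans (∑-cong E (λ u → cong 𝟙 (𝔹.∧-comm ⌊ v ≟ₑ y ⌋ ⌊ u ≟ₑ x ⌋)))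
                                           (trans (∑-edges-δ x (λ _ → ⌊ v ≟ₑ y ⌋)) (cong 𝟙 (≟ₑ-joins y-joins v)))))

      row-cross : ∀ u → ∑ E (cross u) ≡ m * 𝟙 (spoke a b u)
      row-cross u = trans (*-distribˡ-∑ E m _) (cong (m *_) (begin
        ∑ E (λ v → 𝟙 (matched u v))
          ≡⟨ ∑-cong E (λ v → trans (cong 𝟙 (𝔹.∧-assoc (spoke a b u) (spoke c b v) _)) (𝟙-∧ (spoke a b u) _)) ⟩
        ∑ E (λ v → 𝟙 (spoke a b u) * 𝟙 (spoke c b v ∧ A (opposite a u) (opposite c v)))
          ≡⟨ *-distribˡ-∑ E (𝟙 (spoke a b u)) _ ⟩
        𝟙 (spoke a b u) * ∑ E (λ v → 𝟙 (spoke c b v ∧ A (opposite a u) (opposite c v)))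
          ≡⟨ 𝟙-guard (spoke a b u) (∑-partners {a} {b} {c} {u} (trans (symmetric b a) ab) (trans (symmetric b c) cb) a≢c) ⟩
        𝟙 (spoke a b u) * 1ℚ
          ≡⟨ ℚ.*-identityʳ _ ⟩
        𝟙 (spoke a b u) ∎))
        where open ≡-Reasoning

      col-cross : ∀ v → ∑ E (λ u → cross u v) ≡ m * 𝟙 (spoke c b v)
      col-cross v = trans (*-distribˡ-∑ E m _) (cong (m *_) (begin
        ∑ E (λ u → 𝟙 (matched u v))
          ≡⟨ ∑-cong E (λ u → trans (cong 𝟙 (from-c u)) (𝟙-∧ (spoke c b v) _)) ⟩
        ∑ E (λ u → 𝟙 (spoke c b v) * 𝟙 (spoke a b u ∧ A (opposite c v) (opposite a u)))
          ≡⟨ *-distribˡ-∑ E (𝟙 (spoke c b v)) _ ⟩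
        𝟙 (spoke c b v) * ∑ E (λ u → 𝟙 (spoke a b u ∧ A (opposite c v) (opposite a u)))
          ≡⟨ 𝟙-guard (spoke c b v) (∑-partners {c} {b} {a} {v} (trans (symmetric b c) cb) (trans (symmetric b a) ab) (≢-sym a≢c)) ⟩
        𝟙 (spoke c b v) * 1ℚ
          ≡⟨ ℚ.*-identityʳ _ ⟩
        𝟙 (spoke c b v) ∎))
        where
        open ≡-Reasoning
        from-c : ∀ u → matched u v ≡ spoke c b v ∧ (spoke a b u ∧ A (opposite c v) (opposite a u))
        from-c u = trans (cong (_∧ A (opposite a u) (opposite c v)) (𝔹.∧-comm (spoke a b u) (spoke c b v)))
                         (trans (𝔹.∧-assoc (spoke c b v) (spoke a b u) _)
                                (cong (λ z → spoke c b v ∧ (spoke a b u ∧ z)) (symmetric (opposite a u) (opposite c v))))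

      marginal-profile : ∀ α β → m * 𝟙 β + (p - m) * 𝟙 (α ∧ β) + m * 𝟙 (α ∧ not β) ≡ profile α β
      marginal-profile true  true  = solve 2 (λ p m → m :* con 1ℚ :+ (p :- m) :* con 1ℚ :+ m :* con 0ℚ := p) refl p m
      marginal-profile true  false = solve 2 (λ p m → m :* con 0ℚ :+ (p :- m) :* con 0ℚ :+ m :* con 1ℚ := m) refl p m
      marginal-profile false true  = solve 2 (λ p m → m :* con 1ℚ :+ (p :- m) :* con 0ℚ :+ m :* con 0ℚ := m) refl p m
      marginal-profile false false = solve 2 (λ p m → m :* con 0ℚ :+ (p :- m) :* con 0ℚ :+ m :* con 0ℚ := con 0ℚ) refl p m

      plan-row : ∀ u → ∑ E (plan u) ≡ lazyMeasure (LineGraph A) p x u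
      plan-row u = begin
        ∑ E (plan u)
          ≡⟨ trans (∑-distrib-+ E (λ v → stay u v + slide u v) (cross u)) (cong (_+ ∑ E (cross u)) (∑-distrib-+ E (stay u) (slide u))) ⟩
        ∑ E (stay u) + ∑ E (slide u) + ∑ E (cross u)
          ≡⟨ cong₂ _+_ (cong₂ _+_ (row-stay u) (row-slide u)) (row-cross u) ⟩
        m * 𝟙 (incident b u) + (p - m) * 𝟙 (incident a u ∧ incident b u) + m * 𝟙 (spoke a b u)
          ≡⟨ marginal-profile (incident a u) (incident b u) ⟩
        profile (incident a u) (incident b u)
          ≡⟨ sym (measure-profile x-joins u) ⟩
        lazyMeasure (LineGraph A) p x u ∎
        where open ≡-Reasoning

      plan-col : ∀ v → ∑ E (λ u → plan u v) ≡ lazyMeasure (LineGraph A) p y v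
      plan-col v = begin
        ∑ E (λ u → plan u v)
          ≡⟨ trans (∑-distrib-+ E (λ u → stay u v + slide u v) (λ u → cross u v))
                   (cong (_+ ∑ E (λ u → cross u v)) (∑-distrib-+ E (λ u → stay u v) (λ u → slide u v))) ⟩
        ∑ E (λ u → stay u v) + ∑ E (λ u → slide u v) + ∑ E (λ u → cross u v)
          ≡⟨ cong₂ _+_ (cong₂ _+_ (col-stay v) (col-slide v)) (col-cross v) ⟩
        m * 𝟙 (incident b v) + (p - m) * 𝟙 (incident c v ∧ incident b v) + m * 𝟙 (spoke c b v)
          ≡⟨ marginal-profile (incident c v) (incident b v) ⟩
        profile (incident c v) (incident b v)
          ≡⟨ sym (measure-profile y-joins v) ⟩
        lazyMeasure (LineGraph A) p y v ∎
        where open ≡-Reasoning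

      plan-nonNeg : ∀ u v → 0ℚ ≤ℚ plan u v
      plan-nonNeg u v = ℚ.+-mono-≤ (ℚ.+-mono-≤ (*-nonNeg m≥0 (𝟙-nonNeg _)) (*-nonNeg p-m≥0 (𝟙-nonNeg _))) (*-nonNeg m≥0 (𝟙-nonNeg _))
        where
        1-p≥0 : 0ℚ ≤ℚ 1ℚ - p
        1-p≥0 = ℚ.<⇒≤ (p<q⇒0<q-p p<1)
        m≥0 : 0ℚ ≤ℚ m
        m≥0 = *-nonNeg 1-p≥0 (invℕ-nonNeg D)
        1-p<p : 1ℚ - p <ℚ p
        1-p<p = ℚ.<-trans (ℚ.+-monoʳ-< 1ℚ (ℚ.neg-antimono-< ½<p)) ½<p
        m≤p : m ≤ℚ p
        m≤p = ℚ.≤-trans (ℚ.≤-trans (ℚ.*-monoˡ-≤-nonNeg (1ℚ - p) {{ℚ.nonNegative 1-p≥0}} (invℕ≤1 D))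
                                   (ℚ.≤-reflexive (ℚ.*-identityʳ (1ℚ - p))))
                        (ℚ.<⇒≤ 1-p<p)
        p-m≥0 : 0ℚ ≤ℚ p - m
        p-m≥0 = p≤q⇒0≤q-p m≤p

      plan-scaled : ∀ u v X → plan u v * X ≡ m * (𝟙 (stays u v) * X) + (p - m) * (𝟙 (slides u v) * X) + m * (𝟙 (matched u v) * X)
      plan-scaled u v X =
        solve 6 (λ m q s₁ s₂ s₃ X → (m :* s₁ :+ q :* s₂ :+ m :* s₃) :* X := m :* (s₁ :* X) :+ q :* (s₂ :* X) :+ m :* (s₃ :* X))
                refl m (p - m) (𝟙 (stays u v)) (𝟙 (slides u v)) (𝟙 (matched u v)) X

      plan-tight : ∀ u v → plan u v * gap u v ≡ plan u v * fromℕ (dist (LineGraph A) u v)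
      plan-tight u v = begin
        plan u v * gap u v
          ≡⟨ plan-scaled u v (gap u v) ⟩
        m * (𝟙 (stays u v) * gap u v) + (p - m) * (𝟙 (slides u v) * gap u v) + m * (𝟙 (matched u v) * gap u v)
          ≡⟨ cong₂ _+_ (cong₂ _+_ (cong (m *_) (𝟙-guard (stays u v) (λ on → tight (stays-support u v on))))
                                  (cong ((p - m) *_) (𝟙-guard (slides u v) (λ on → tight (slides-support u v on)))))
                       (cong (m *_) (𝟙-guard (matched u v) (λ on → tight (matched-support u v on)))) ⟩
        m * (𝟙 (stays u v) * δ) + (p - m) * (𝟙 (slides u v) * δ) + m * (𝟙 (matched u v) * δ)
          ≡⟨ sym (plan-scaled u v δ) ⟩
        plan u v * δ ∎
        where
        open ≡-Reasoning
        δ = fromℕ (dist (LineGraph A) u v)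
        tight : ∀ {k} → gap u v ≡ k × δ ≡ k → gap u v ≡ δ
        tight (gap≡k , δ≡k) = trans gap≡k (sym δ≡k)

      plan-cost-at : ∀ u v → plan u v * fromℕ (dist (LineGraph A) u v) ≡ slide u v + fromℕ 2 * cross u v
      plan-cost-at u v = begin
        plan u v * δ
          ≡⟨ plan-scaled u v δ ⟩
        m * (𝟙 (stays u v) * δ) + (p - m) * (𝟙 (slides u v) * δ) + m * (𝟙 (matched u v) * δ)
          ≡⟨ cong₂ _+_ (cong₂ _+_ (cong (m *_) (𝟙-guard (stays u v) (λ on → proj₂ (stays-support u v on))))
                                  (cong ((p - m) *_) (𝟙-guard (slides u v) (λ on → proj₂ (slides-support u v on)))))
                       (cong (m *_) (𝟙-guard (matched u v) (λ on → proj₂ (matched-support u v on)))) ⟩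
        m * (𝟙 (stays u v) * 0ℚ) + (p - m) * (𝟙 (slides u v) * 1ℚ) + m * (𝟙 (matched u v) * fromℕ 2)
          ≡⟨ solve 5 (λ m q s₁ s₂ s₃ → m :* (s₁ :* con 0ℚ) :+ q :* (s₂ :* con 1ℚ) :+ m :* (s₃ :* con (fromℕ 2))
                                      := q :* s₂ :+ con (fromℕ 2) :* (m :* s₃))
                     refl m (p - m) (𝟙 (stays u v)) (𝟙 (slides u v)) (𝟙 (matched u v)) ⟩
        slide u v + fromℕ 2 * cross u v ∎
        where
        open ≡-Reasoning
        δ = fromℕ (dist (LineGraph A) u v)

      plan-cost : cost (LineGraph A) plan ≡ (p - m) * 1ℚ + fromℕ 2 * (m * (fromℕ d - 1ℚ))
      plan-cost = begin
        ∑ E (λ u → ∑ E (λ v → plan u v * fromℕ (dist (LineGraph A) u v)))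
          ≡⟨ ∑-cong E (λ u → trans (∑-cong E (plan-cost-at u)) (row-cost u)) ⟩
        ∑ E (λ u → (p - m) * 𝟙 (incident a u ∧ incident b u) + fromℕ 2 * (m * 𝟙 (spoke a b u)))
          ≡⟨ trans (∑-distrib-+ E _ _) (cong₂ _+_ (*-distribˡ-∑ E (p - m) _)
                                                  (trans (*-distribˡ-∑ E (fromℕ 2) _) (cong (fromℕ 2 *_) (*-distribˡ-∑ E m _)))) ⟩
        (p - m) * ∑ E (λ u → 𝟙 (incident a u ∧ incident b u)) + fromℕ 2 * (m * ∑ E (λ u → 𝟙 (spoke a b u)))
          ≡⟨ cong₂ (λ s t → (p - m) * s + fromℕ 2 * (m * t)) (∑-edges-joins x-joins) (∑-spokes x-joins) ⟩
        (p - m) * 1ℚ + fromℕ 2 * (m * (fromℕ d - 1ℚ)) ∎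
        where
        open ≡-Reasoning
        row-cost : ∀ u → ∑ E (λ v → slide u v + fromℕ 2 * cross u v)
                         ≡ (p - m) * 𝟙 (incident a u ∧ incident b u) + fromℕ 2 * (m * 𝟙 (spoke a b u))
        row-cost u = trans (∑-distrib-+ E (slide u) _)
                           (cong₂ _+_ (row-slide u) (trans (*-distribˡ-∑ E (fromℕ 2) (cross u)) (cong (fromℕ 2 *_) (row-cross u))))

      κₚ-value : invℕ D * (1ℚ - p) ≡ 1ℚ - cost (LineGraph A) plan
      κₚ-value = begin
        I * (1ℚ - p)
          ≡⟨ solve 2 (λ I p → I :* (con 1ℚ :- p) := I :* (con 1ℚ :- p) :+ (con 1ℚ :- p) :* (con 1ℚ :- con 1ℚ)) refl I p ⟩
        I * (1ℚ - p) + (1ℚ - p) * (1ℚ - 1ℚ)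
          ≡⟨ cong (λ z → I * (1ℚ - p) + (1ℚ - p) * (1ℚ - z)) (sym (invℕ-inverseˡ D)) ⟩
        I * (1ℚ - p) + (1ℚ - p) * (1ℚ - I * fromℕ D)
          ≡⟨ cong (λ z → I * (1ℚ - p) + (1ℚ - p) * (1ℚ - I * z)) (fromℕ-2*d∸2 d (ℕ.≤-trans (s≤s z≤n) d≥2)) ⟩
        I * (1ℚ - p) + (1ℚ - p) * (1ℚ - I * (fromℕ d + fromℕ d - fromℕ 2))
          ≡⟨ solve 3 (λ I p δ → I :* (con 1ℚ :- p) :+ (con 1ℚ :- p) :* (con 1ℚ :- I :* (δ :+ δ :- con (fromℕ 2)))
                              := con 1ℚ :- ((p :- (con 1ℚ :- p) :* I) :* con 1ℚ :+ con (fromℕ 2) :* (((con 1ℚ :- p) :* I) :* (δ :- con 1ℚ))))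
                     refl I p (fromℕ d) ⟩
        1ℚ - ((p - m) * 1ℚ + fromℕ 2 * (m * (fromℕ d - 1ℚ)))
          ≡⟨ cong (1ℚ -_) (sym plan-cost) ⟩
        1ℚ - cost (LineGraph A) plan ∎
        where
        open ≡-Reasoning
        I = invℕ D

      κₚ : IsKappaP (LineGraph A) p x y (invℕ D * (1ℚ - p))
      κₚ = isKappaP-adjacent (LineGraph A) (dist-adjacent x≢y x~y)
             (isW1-byPotential (LineGraph A) (λ u → fromℕ (potential u)) (plan-nonNeg , plan-row , plan-col) gap-lipschitz plan-tight)
             κₚ-value

    curvature : IsLLYCurvature (LineGraph A) x y (invℕ D)
    curvature = isLLYCurvature-byExactκₚ (LineGraph A) (invℕ D) Plan.κₚ

lemma3p3 : (n d : ℕ) (A : Fin n → Fin n → Bool) → IsSRG n A d 0 1 →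
           (x y : Edge A) → lineAdj A x y ≡ true →
           IsLLYCurvature (LineGraph A) x y (invℕ (2 ℕ.* d ∸ 2))
lemma3p3 n d A srg x y x~y = WedgeTransport.curvature (wedge x~y)
  where open MooreGraph srg
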